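{- Let $\mathcal X$ be a reduced Klein configuration with fiber index set $I$ such that for every $i\in I$ there exists $j\in I\setminus\{i\}$ with $R_{ji}\ne G$, and suppose moreover that $R_{ij}\ne G$ for all $i,j\in I$. Then either $|L|=1$, or $|I|\le 7$ and $\mathcal G=(I,L)$ is a projective plane of order $2$ or an affine plane of order $2$, or $\mathcal G$ is isomorphic to one of the following four linear spaces: (a) $3$ points and three lines of size $2$; (b) $4$ points, one line of size $3$ and three lines of size $2$; (c) $5$ points, two lines of size $3$ meeting in one point, and four lines of size $2$; (d) $6$ points, four lines of size $3$ any two of which meet in exactly one point with no three through a common point, and three lines of size $2$.
   Context: Let $G$ be a Klein four-group. A coherent configuration is a pair $(\Omega,S)$ with $\Omega$ finite and $S$ a partition of $\Omega\times\Omega$ such that $1_\Omega$ is a union of elements of $S$, $S$ is closed under transposition, and for $u,v,w\in S$ the number $|\alpha u\cap\gamma v^*|$ is independent of $(\alpha,\gamma)\in w$. Fibers are the sets $\Delta$ with $1_\Delta\in S$. A Klein configuration is a coherent configuration in which the restriction to each fiber $\Delta$ (basic relations contained in $\Delta\times\Delta$) is the orbit scheme of a regular permutation group on $\Delta$ isomorphic to $G$. Write the fibers as $\Omega_i$, $i\in I$, $S_{ij}=\{s\in S: s\subseteq\Omega_i\times\Omega_j\}$; $S_{ii}$ is a group under relational product $\cdot$ isomorphic to $G$, and group isomorphisms $G\to S_{ii}$, $g\mapsto g_i$, are fixed. Set $R_{ij}=\{g\in G:s\cdot g_j=s\}$, which does not depend on $s\in S_{ij}$. The configuration is reduced if $R_{ij}\ne\{1\}$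 for all distinct $i,j$. The incidence structure $\mathcal G=(I,L)$ has point set $I$ and line set $L$ consisting of all sets $L_i(H)=\{i\}\cup\{j\in I:R_{ji}=H\}$, where $i\in I$ and $H$ is a subgroup of $G$ of order $2$ with $H=R_{ji}$ for some $j\in I\setminus\{i\}$. A linear space is an incidence structure in which every line has at least two points and any two distinct points lie on exactly one common line. -}

module Defs where

open import Data.Nat using (ℕ; zero; suc; _+_; _≤_; _<_)
open import Data.Fin using (Fin; zero; suc; _≟_; #_)
open import Data.Bool using (Bool; true; false; _xor_; _∧_; if_then_else_)
open import Data.Product using (Σ; _×_; _,_; Σ-syntax)
open import Data.Sum using (_⊎_)
open import Data.Empty using (⊥)
open import Data.List using (List; []; _∷_)
open import Data.List.Membership.Propositional using (_∈_)
open import Relation.Binary.PropositionalEquality using (_≡_; _≢_)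
open import Relation.Nullary using (¬_)
open import Relation.Nullary.Decidable using (⌊_⌋)
open import Function.Bundles using (_⇔_; _↔_; Inverse)

G : Set
G = Bool × Bool

e : G
e = false , false

_∙_ : G → G → G
(a , b) ∙ (c , d) = (a xor c) , (b xor d)

-- Coherent configurations.
-- Ω = Fin n; the partition S of Ω × Ω into m basic relations is given by
-- rel : Fin n → Fin n → Fin m, where the basic relation with index s is
-- { (α , β) | rel α β ≡ s }  (every index is required to be used, so the
-- blocks are nonempty and distinct indices give distinct blocks).

count : ∀ {n} → (Fin n → Bool) → ℕ
count {zero}  f = 0
count {suc n} f = (if f zero then 1 else 0) + count (λ x → f (suc x))

-- | α u ∩ γ v* |  =  #{ β | (α,β) ∈ u , (β,γ) ∈ v }
isect : ∀ {n m} → (Fin n → Fin n → Fin m) → Fin m → Fin m → Fin n → Fin n → ℕ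
isect rel u v α γ = count (λ β → ⌊ rel α β ≟ u ⌋ ∧ ⌊ rel β γ ≟ v ⌋)

record IsCoherentConfiguration {n m : ℕ} (rel : Fin n → Fin n → Fin m) : Set where
  field
    block-nonempty : ∀ s → Σ[ α ∈ Fin n ] Σ[ β ∈ Fin n ] rel α β ≡ s
    -- 1_Ω is a union of basic relations
    diagonal       : ∀ α β γ → rel α α ≡ rel β γ → β ≡ γ
    transpose      : ∀ α β γ δ → rel α β ≡ rel γ δ → rel β α ≡ rel δ γ
    intersection   : ∀ u v α γ α' γ' → rel α γ ≡ rel α' γ' →
                     isect rel u v α γ ≡ isect rel u v α' γ'

RelProd : ∀ {n m} → (Fin n → Fin n → Fin m) → Fin m → Fin m → Fin m → Set
RelProd rel s t u =
  ∀ α γ → (Σ[ β ∈ _ ] (rel α β ≡ s × rel β γ ≡ t)) ⇔ (rel α γ ≡ u)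

-- Fibers.  The fiber index set I is Fin k; ι i is the index of the basic
-- relation 1_{Ω_i}.  ι is a bijection onto the reflexive basic relations.

record IsFiberIndexing {n m k : ℕ} (rel : Fin n → Fin n → Fin m)
                       (ι : Fin k → Fin m) : Set where
  field
    ι-injective : ∀ i j → ι i ≡ ι j → i ≡ j
    ι-reflexive : ∀ i → Σ[ α ∈ Fin n ] rel α α ≡ ι i
    ι-onto      : ∀ α → Σ[ i ∈ Fin k ] rel α α ≡ ι i

InFiber : ∀ {n m k} → (Fin n → Fin n → Fin m) → (Fin k → Fin m) →
          Fin k → Fin n → Set
InFiber rel ι i α = rel α α ≡ ι i

-- The restriction of the configuration to the fiber Δ is the orbit scheme
-- of a regular permutation group on Δ isomorphic to G: i.e. there is a
-- regular (hence faithful) action of G on Δ whose orbits on Δ × Δ are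
-- exactly the basic relations contained in Δ × Δ.
record IsRegularOrbitScheme {n m : ℕ} (rel : Fin n → Fin n → Fin m)
                            (Δ : Fin n → Set) (act : G → Fin n → Fin n) : Set where
  field
    act-closed : ∀ g α → Δ α → Δ (act g α)
    act-e      : ∀ α → Δ α → act e α ≡ α
    act-∙      : ∀ g h α → Δ α → act (g ∙ h) α ≡ act h (act g α)
    regular    : ∀ α β → Δ α → Δ β →
                 Σ[ g ∈ G ] (act g α ≡ β × (∀ g' → act g' α ≡ β → g' ≡ g))
    orbits     : ∀ α β α' β' → Δ α → Δ β → Δ α' → Δ β' →
                 (rel α β ≡ rel α' β') ⇔ (Σ[ g ∈ G ] (act g α ≡ α' × act g β ≡ β'))

IsKleinConfiguration : ∀ {n m k} → (Fin n → Fin n → Fin m) → (Fin k → Fin m) → Set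
IsKleinConfiguration {n} rel ι =
  ∀ i → Σ[ act ∈ (G → Fin n → Fin n) ] IsRegularOrbitScheme rel (InFiber rel ι i) act

-- fixed group isomorphisms G → S_ii , g ↦ g_i  (= φ i g)
record IsFiberIsomorphisms {n m k : ℕ} (rel : Fin n → Fin n → Fin m)
                           (ι : Fin k → Fin m) (φ : Fin k → G → Fin m) : Set where
  field
    φ-in-S-ii    : ∀ i g α β → rel α β ≡ φ i g → InFiber rel ι i α × InFiber rel ι i β
    φ-injective  : ∀ i g h → φ i g ≡ φ i h → g ≡ h
    φ-surjective : ∀ i α β → InFiber rel ι i α → InFiber rel ι i β →
                   Σ[ g ∈ G ] rel α β ≡ φ i g
    φ-hom        : ∀ i g h → RelProd rel (φ i g) (φ i h) (φ i (g ∙ h))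

-- g ∈ R_ij  iff  s · g_j = s  for the basic relations s ∈ S_ij
R : ∀ {n m k} → (Fin n → Fin n → Fin m) → (Fin k → Fin m) → (Fin k → G → Fin m) →
    Fin k → Fin k → G → Set
R rel ι φ i j g = ∀ α β → InFiber rel ι i α → InFiber rel ι j β →
                  RelProd rel (rel α β) (φ j g) (rel α β)

R≡⟨_⟩ : ∀ {n m k} → G → (Fin n → Fin n → Fin m) → (Fin k → Fin m) →
        (Fin k → G → Fin m) → Fin k → Fin k → Set
R≡⟨ h ⟩ rel ι φ i j = ∀ g → R rel ι φ i j g ⇔ (g ≡ e ⊎ g ≡ h)

-- Incidence structures on the point set Fin k: a line is a predicate on
-- points (a subset), and an incidence structure is the predicate "is a line".

Incidence : ℕ → Set₁
Incidence k = (Fin k → Set) → Set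

_≐_ : ∀ {k} → (Fin k → Set) → (Fin k → Set) → Set
ℓ ≐ ℓ' = ∀ x → ℓ x ⇔ ℓ' x

-- the incidence structure 𝒢 = (I , L):  lines are the L_i(H), where H = {e , h}
-- (h ≠ e) is a subgroup of order 2 with H = R_ji for some j ≠ i
LinePt : ∀ {n m k} → (Fin n → Fin n → Fin m) → (Fin k → Fin m) →
         (Fin k → G → Fin m) → Fin k → G → Fin k → Set
LinePt rel ι φ i h x = x ≡ i ⊎ R≡⟨ h ⟩ rel ι φ x i

𝒢 : ∀ {n m k} → (Fin n → Fin n → Fin m) → (Fin k → Fin m) →
    (Fin k → G → Fin m) → Incidence k
𝒢 {k = k} rel ι φ ℓ =
  Σ[ i ∈ Fin k ] Σ[ h ∈ G ]
    (h ≢ e × (Σ[ j ∈ Fin k ] (j ≢ i × R≡⟨ h ⟩ rel ι φ j i)) × ℓ ≐ LinePt rel ι φ i h)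

HasOneLine : ∀ {k} → Incidence k → Set₁
HasOneLine {k} Line = Σ[ ℓ ∈ (Fin k → Set) ] (Line ℓ × (∀ ℓ' → Line ℓ' → ℓ' ≐ ℓ))

HasExactly2 : ∀ {k} → (Fin k → Set) → Set
HasExactly2 {k} ℓ = Σ[ a ∈ Fin k ] Σ[ b ∈ Fin k ]
  (a ≢ b × (∀ x → ℓ x ⇔ (x ≡ a ⊎ x ≡ b)))

HasExactly3 : ∀ {k} → (Fin k → Set) → Set
HasExactly3 {k} ℓ = Σ[ a ∈ Fin k ] Σ[ b ∈ Fin k ] Σ[ c ∈ Fin k ]
  (a ≢ b × a ≢ c × b ≢ c × (∀ x → ℓ x ⇔ (x ≡ a ⊎ x ≡ b ⊎ x ≡ c)))

Collinear : ∀ {k} → Incidence k → Fin k → Fin k → Fin k → Set₁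
Collinear {k} Line a b c = Σ[ ℓ ∈ (Fin k → Set) ] (Line ℓ × ℓ a × ℓ b × ℓ c)

Disjoint : ∀ {k} → (Fin k → Set) → (Fin k → Set) → Set
Disjoint ℓ ℓ' = ∀ x → ℓ x → ℓ' x → ⊥

UniqueJoin : ∀ {k} → Incidence k → Set₁
UniqueJoin {k} Line = ∀ p q → p ≢ q →
  Σ[ ℓ ∈ (Fin k → Set) ] (Line ℓ × ℓ p × ℓ q × (∀ ℓ' → Line ℓ' → ℓ' p → ℓ' q → ℓ' ≐ ℓ))

record IsProjectivePlaneOfOrder2 {k : ℕ} (Line : Incidence k) : Set₁ where
  field
    join       : UniqueJoin Line
    meet       : ∀ ℓ ℓ' → Line ℓ → Line ℓ' → ¬ (ℓ ≐ ℓ') →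
                 Σ[ x ∈ Fin k ] (ℓ x × ℓ' x × (∀ y → ℓ y → ℓ' y → y ≡ x))
    quadrangle : Σ[ a ∈ Fin k ] Σ[ b ∈ Fin k ] Σ[ c ∈ Fin k ] Σ[ d ∈ Fin k ]
                 (a ≢ b × a ≢ c × a ≢ d × b ≢ c × b ≢ d × c ≢ d ×
                  ¬ Collinear Line a b c × ¬ Collinear Line a b d ×
                  ¬ Collinear Line a c d × ¬ Collinear Line b c d)
    order2     : ∀ ℓ → Line ℓ → HasExactly3 ℓ

record IsAffinePlaneOfOrder2 {k : ℕ} (Line : Incidence k) : Set₁ where
  field
    join     : UniqueJoin Line
    parallel : ∀ ℓ p → Line ℓ → ¬ ℓ p →
               Σ[ ℓ' ∈ (Fin k → Set) ] (Line ℓ' × ℓ' p × Disjoint ℓ ℓ' ×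
                 (∀ ℓ'' → Line ℓ'' → ℓ'' p → Disjoint ℓ ℓ'' → ℓ'' ≐ ℓ'))
    triangle : Σ[ a ∈ Fin k ] Σ[ b ∈ Fin k ] Σ[ c ∈ Fin k ]
               (a ≢ b × a ≢ c × b ≢ c × ¬ Collinear Line a b c)
    order2   : ∀ ℓ → Line ℓ → HasExactly2 ℓ

IsomorphicTo : ∀ {k} → Incidence k → (p : ℕ) → List (List (Fin p)) → Set₁
IsomorphicTo {k} Line p M =
  Σ[ σ ∈ (Fin k ↔ Fin p) ]
    ((∀ ℓ → Line ℓ → Σ[ N ∈ List (Fin p) ]
        (N ∈ M × (∀ x → ℓ x ⇔ (Inverse.to σ x ∈ N)))) ×
     (∀ N → N ∈ M → Σ[ ℓ ∈ (Fin k → Set) ]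
        (Line ℓ × (∀ x → ℓ x ⇔ (Inverse.to σ x ∈ N)))))

spaceA : List (List (Fin 3))
spaceA = (# 0 ∷ # 1 ∷ []) ∷ (# 0 ∷ # 2 ∷ []) ∷ (# 1 ∷ # 2 ∷ []) ∷ []

spaceB : List (List (Fin 4))
spaceB = (# 0 ∷ # 1 ∷ # 2 ∷ []) ∷
         (# 0 ∷ # 3 ∷ []) ∷ (# 1 ∷ # 3 ∷ []) ∷ (# 2 ∷ # 3 ∷ []) ∷ []

spaceC : List (List (Fin 5))
spaceC = (# 0 ∷ # 1 ∷ # 2 ∷ []) ∷ (# 0 ∷ # 3 ∷ # 4 ∷ []) ∷
         (# 1 ∷ # 3 ∷ []) ∷ (# 1 ∷ # 4 ∷ []) ∷
         (# 2 ∷ # 3 ∷ []) ∷ (# 2 ∷ # 4 ∷ []) ∷ []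

spaceD : List (List (Fin 6))
spaceD = (# 0 ∷ # 1 ∷ # 2 ∷ []) ∷ (# 0 ∷ # 3 ∷ # 4 ∷ []) ∷
         (# 1 ∷ # 3 ∷ # 5 ∷ []) ∷ (# 2 ∷ # 4 ∷ # 5 ∷ []) ∷
         (# 0 ∷ # 5 ∷ []) ∷ (# 1 ∷ # 4 ∷ []) ∷ (# 2 ∷ # 3 ∷ []) ∷ []

module Submission where

-- 1. From intersection numbers and the thin fibre groups S_ii ≅ G we show that
--    each R_ij is a subgroup of G, and the exchange lemma
--    R_ba ⊆ R_da ⇒ R_bd ⊆ R_ad (R-exchange).
-- 2. Under the hypotheses each R_xi (x ≠ i) has order 2; its generator is the
--    colour of x seen from i.  The exchange lemma turns into the exchange law
--    of a Klein colouring, whose lines (colour classes together with their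
--    centre) are exactly the lines of 𝒢 (ReducedColouring).
-- 3. Klein colourings are classified (Classify): if a point sees one colour
--    there is a single line; otherwise, as G has only three involutions, lines
--    have at most three points, and a line with a point off it (a frame)
--    identifies (b), (c), (d) or the Fano plane, while without three collinear
--    points we get (a) or the affine plane.
-- 4. Each identification is an isomorphism with an explicit list of lines
--    (Recognition); the finitely many facts about these lists are checked by
--    evaluating decision procedures.

open import Defs
open import Data.Nat using (ℕ; zero; suc; _≤_; _<_; s≤s; z≤n)
open import Data.Nat.Properties using (≤-trans)
open import Data.Fin using (Fin; zero; suc; _≟_; #_)
open import Data.Bool using (Bool; true; false; _∧_; T; _xor_; if_then_else_)
open import Data.Bool.Properties using (xor-same; xor-comm; xor-assoc; xor-identityʳ; T-∧)
  renaming (_≟_ to _≟B_)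
open import Data.Product using (_×_; _,_; Σ-syntax; proj₁; proj₂)
open import Data.Product.Properties using (≡-dec)
open import Data.Sum using (_⊎_; inj₁; inj₂)
import Data.Sum as Sum
open import Data.Empty using (⊥; ⊥-elim)
open import Relation.Binary.PropositionalEquality
open import Relation.Nullary using (¬_; Dec; yes; no)
open import Relation.Nullary.Decidable
  using (⌊_⌋; True; toWitness; fromWitness; _→-dec_; _×-dec_; _⊎-dec_; ¬?)
open import Data.List using (List; []; _∷_; concatMap)
import Data.List.Properties as List
open import Data.List.Membership.Propositional using (_∈_; _∉_)
open import Data.List.Relation.Unary.All as All using (All; []; _∷_)
import Data.List.Relation.Unary.Any as Any
open import Data.List.Relation.Unary.Any using (here; there)
open import Data.List.Relation.Unary.All.Properties using (concat⁺; map⁺)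
open import Data.Vec using (Vec; lookup; []; _∷_; _++_)
open import Data.Vec.Relation.Unary.Any using (here; there)
open import Data.Vec.Relation.Unary.All using ([]; _∷_)
open import Data.Vec.Relation.Unary.AllPairs using ([]; _∷_)
open import Data.Vec.Membership.Propositional using () renaming (_∈_ to _∈ᵥ_)
open import Data.Vec.Membership.Propositional.Properties using (∈-lookup; ∈-++⁺ˡ; ∈-++⁺ʳ)
import Data.Vec.Relation.Unary.Any as Anyᵥ
open import Data.Vec.Relation.Unary.Any.Properties using (lookup-index)
open import Data.Vec.Relation.Unary.Unique.Propositional using (Unique)
open import Data.Vec.Relation.Unary.Unique.Propositional.Properties using (lookup-injective)
open import Data.Fin.Properties using (any?; all?; injective⇒≤; ¬∀⟶∃¬)
open import Function using (id; _∘_)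
open import Function.Bundles using (_⇔_; mk⇔; Equivalence; _↔_; mk↔ₛ′; Inverse)
open Equivalence using () renaming (to to ⇔to; from to ⇔from)

_≟G_ : (g h : G) → Dec (g ≡ h)
_≟G_ = ≡-dec _≟B_ _≟B_

allG : {P : G → Set} → (∀ g → Dec (P g)) → Dec (∀ g → P g)
allG P? with P? (false , false) | P? (false , true) | P? (true , false) | P? (true , true)
... | yes p₀ | yes p₁ | yes p₂ | yes p₃ =
  yes λ { (false , false) → p₀ ; (false , true) → p₁ ; (true , false) → p₂ ; (true , true) → p₃ }
... | no ¬p | _ | _ | _ = no λ all → ¬p (all _)
... | _ | no ¬p | _ | _ = no λ all → ¬p (all _)
... | _ | _ | no ¬p | _ = no λ all → ¬p (all _)
... | _ | _ | _ | no ¬p = no λ all → ¬p (all _)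

∙-self : ∀ g → g ∙ g ≡ e
∙-self (a , b) = cong₂ _,_ (xor-same a) (xor-same b)

-- conjugation is trivial, in the form needed to cancel a round trip g, x, g
∙-conjugate : ∀ g x → (g ∙ x) ∙ g ≡ x
∙-conjugate (a , b) (c , d) = cong₂ _,_ (cancel a c) (cancel b d)
  where
  cancel : ∀ a c → (a xor c) xor a ≡ c
  cancel a c = begin
    (a xor c) xor a  ≡⟨ cong (_xor a) (xor-comm a c) ⟩
    (c xor a) xor a  ≡⟨ xor-assoc c a a ⟩
    c xor (a xor a)  ≡⟨ cong (c xor_) (xor-same a) ⟩
    c xor false      ≡⟨ xor-identityʳ c ⟩
    c                ∎
    where open ≡-Reasoning

opaque
  generated : ∀ g h x → g ≢ e → h ≢ e → g ≢ h → x ≡ e ⊎ x ≡ g ⊎ x ≡ h ⊎ x ≡ g ∙ h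
  generated = toWitness {a? = allG λ g → allG λ h → allG λ x →
    ¬? (g ≟G e) →-dec (¬? (h ≟G e) →-dec (¬? (g ≟G h) →-dec
      ((x ≟G e) ⊎-dec ((x ≟G g) ⊎-dec ((x ≟G h) ⊎-dec (x ≟G (g ∙ h)))))))} _

  -- pigeonhole: G has only three involutions, so among four two coincide
  three-involutions : ∀ a b c d → a ≢ e → b ≢ e → c ≢ e → d ≢ e →
    a ≡ b ⊎ a ≡ c ⊎ a ≡ d ⊎ b ≡ c ⊎ b ≡ d ⊎ c ≡ d
  three-involutions = toWitness {a? = allG λ a → allG λ b → allG λ c → allG λ d →
    ¬? (a ≟G e) →-dec (¬? (b ≟G e) →-dec (¬? (c ≟G e) →-dec (¬? (d ≟G e) →-dec
      ((a ≟G b) ⊎-dec ((a ≟G c) ⊎-dec ((a ≟G d) ⊎-dec ((b ≟G c) ⊎-dec ((b ≟G d) ⊎-dec (c ≟G d)))))))))} _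

count-nonzero : ∀ {n} (f : Fin n → Bool) (x : Fin n) → T (f x) → count f ≢ 0
count-nonzero f zero fx with f zero
... | true = λ ()
count-nonzero f (suc x) fx with f zero
... | true  = λ ()
... | false = count-nonzero (λ y → f (suc y)) x fx

count-witness : ∀ {n} (f : Fin n → Bool) → count f ≢ 0 → Σ[ x ∈ Fin n ] T (f x)
count-witness {zero} f count≢0 = ⊥-elim (count≢0 refl)
count-witness {suc n} f count≢0 with f zero in f₀
... | true  = zero , subst T (sym f₀) _
... | false = let (x , fx) = count-witness (λ y → f (suc y)) count≢0 in suc x , fx

module Configuration {n m : ℕ} (rel : Fin n → Fin n → Fin m)
                     (cc : IsCoherentConfiguration rel) where
  open IsCoherentConfiguration cc

  -- Intersection numbers: a path α → z → γ with colours (u , v) between the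
  -- ends of one pair can be found between the ends of every pair of the same colour.
  transfer : ∀ {α γ α' γ' z u v} → rel α γ ≡ rel α' γ' → rel α z ≡ u → rel z γ ≡ v →
             Σ[ z' ∈ Fin n ] (rel α' z' ≡ u × rel z' γ' ≡ v)
  transfer {α} {γ} {α'} {γ'} {z} {u} {v} same αz zγ =
    let (z' , hit) = count-witness (paths α' γ') (subst (_≢ 0) (intersection u v α γ α' γ' same) some-path)
        (α'z' , z'γ') = ⇔to (T-∧ {⌊ rel α' z' ≟ u ⌋}) hit
    in z' , toWitness α'z' , toWitness z'γ'
    where
    paths : Fin n → Fin n → Fin n → Bool
    paths a b β = ⌊ rel a β ≟ u ⌋ ∧ ⌊ rel β b ≟ v ⌋
    some-path : count (paths α γ) ≢ 0
    some-path = count-nonzero (paths α γ) z (⇔from (T-∧ {⌊ rel α z ≟ u ⌋}) (fromWitness αz , fromWitness zγ))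

  same-source-fibre : ∀ {α γ α' γ'} → rel α γ ≡ rel α' γ' → rel α' α' ≡ rel α α
  same-source-fibre {α} {α' = α'} same with transfer {z = α} same refl refl
  ... | z , α'z , _ with diagonal α α' z (sym α'z)
  ... | refl = α'z

  same-target-fibre : ∀ {α γ α' γ'} → rel α γ ≡ rel α' γ' → rel γ' γ' ≡ rel γ γ
  same-target-fibre {γ = γ} {γ' = γ'} same with transfer {z = γ} same refl refl
  ... | z , _ , zγ' with diagonal γ z γ' (sym zγ')
  ... | refl = zγ'

module KleinStructure {n m k : ℕ} (rel : Fin n → Fin n → Fin m) (cc : IsCoherentConfiguration rel)
                      (ι : Fin k → Fin m) (fi : IsFiberIndexing rel ι)
                      (φ : Fin k → G → Fin m) (fs : IsFiberIsomorphisms rel ι φ) where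
  open IsCoherentConfiguration cc
  open IsFiberIsomorphisms fs
  open Configuration rel cc public

  Fib : Fin k → Fin n → Set
  Fib = InFiber rel ι

  fibre-point : ∀ i → Σ[ α ∈ Fin n ] Fib i α
  fibre-point = IsFiberIndexing.ι-reflexive fi

  fibre-ends : ∀ {j α β g} → rel α β ≡ φ j g → Fib j α × Fib j β
  fibre-ends {j} {α} {β} {g} = φ-in-S-ii j g α β

  fibre-identity : ∀ {j α} → Fib j α → rel α α ≡ φ j e
  fibre-identity {j} {α} α∈ =
    let (g , αα) = φ-surjective j α α α∈ α∈
    in subst (λ t → rel α α ≡ φ j t) (∙-self g) (⇔to (φ-hom j g g α α) (α , αα , αα))

  neighbour : ∀ {j α} g → Fib j α → Σ[ β ∈ Fin n ] (rel α β ≡ φ j g × rel β α ≡ φ j g)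
  neighbour {j} {α} g α∈ =
    ⇔from (φ-hom j g g α α) (trans (fibre-identity α∈) (cong (φ j) (sym (∙-self g))))

  fibre-sym : ∀ {j α β g} → rel α β ≡ φ j g → rel β α ≡ φ j g
  fibre-sym {j} {α} {β} {g} αβ =
    let (β' , αβ' , β'α) = neighbour g (proj₁ (fibre-ends αβ))
    in trans (transpose α β α β' (trans αβ (sym αβ'))) β'α

  fibre-comp : ∀ {j α β γ g h} → rel α β ≡ φ j g → rel β γ ≡ φ j h → rel α γ ≡ φ j (g ∙ h)
  fibre-comp {j} {α} {β} {γ} {g} {h} αβ βγ = ⇔to (φ-hom j g h α γ) (β , αβ , βγ)

  fibre-unique : ∀ {j α β β' g} → rel α β ≡ φ j g → rel α β' ≡ φ j g → β ≡ β'
  fibre-unique {j} {α} {β} {β'} {g} αβ αβ' =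
    diagonal β β β' (trans (fibre-identity (proj₂ (fibre-ends αβ)))
      (sym (trans (fibre-comp (fibre-sym αβ) αβ') (cong (φ j) (∙-self g)))))

  shift-target : ∀ {j α β α' β' β₁ β₁' x} → rel α β ≡ rel α' β' →
                 rel β β₁ ≡ φ j x → rel β' β₁' ≡ φ j x → rel α β₁ ≡ rel α' β₁'
  shift-target {β₁ = β₁} same ββ₁ β'β₁' with transfer {z = β₁} same refl (fibre-sym ββ₁)
  ... | y , α'y , yβ' with fibre-unique (fibre-sym yβ') β'β₁'
  ... | refl = sym α'y

  shift-source : ∀ {i α β α' β' α₁ α₁' y} → rel α β ≡ rel α' β' →
                 rel α α₁ ≡ φ i y → rel α' α₁' ≡ φ i y → rel α₁ β ≡ rel α₁' β'
  shift-source {α₁ = α₁} same αα₁ α'α₁' with transfer {z = α₁} same αα₁ refl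
  ... | w , α'w , wβ' with fibre-unique α'w α'α₁'
  ... | refl = sym wβ'

  R-elim : ∀ {i j g α β β'} → R rel ι φ i j g → Fib i α → Fib j β →
           rel β β' ≡ φ j g → rel α β' ≡ rel α β
  R-elim {α = α} {β} {β'} g∈R α∈ β∈ ββ' = ⇔to (g∈R α β α∈ β∈ α β') (β , refl , ββ')

  R-intro : ∀ {i j g α β β'} → Fib i α → Fib j β → rel β β' ≡ φ j g → rel α β ≡ rel α β' →
            R rel ι φ i j g
  R-intro {i} {j} {g} {α} {β} {β'} α∈ β∈ ββ' αβ≡αβ' α₁ β₁ α₁∈ β₁∈ a γ = mk⇔ forth back
    where
    -- shifting (α , β) to (a , z) by group elements carries the given pair
    -- β → β' along; in G the shifts commute with g
    everywhere : ∀ {a z z'} → Fib i a → Fib j z → rel z z' ≡ φ j g → rel a z' ≡ rel a z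
    everywhere {a} {z} {z'} a∈ z∈ zz' with φ-surjective i α a α∈ a∈ | φ-surjective j β z β∈ z∈
    ... | y , αa | x , βz = sym (shift-target (shift-source αβ≡αβ' αa αa) βz β'z')
      where
      β'z' : rel β' z' ≡ φ j x
      β'z' = subst (λ t → rel β' z' ≡ φ j t) (∙-conjugate g x)
                   (fibre-comp (fibre-comp (fibre-sym ββ') βz) zz')
    source∈ : ∀ {a' b'} → rel a' b' ≡ rel α₁ β₁ → Fib i a'
    source∈ same = trans (same-source-fibre (sym same)) α₁∈
    target∈ : ∀ {a' b'} → rel a' b' ≡ rel α₁ β₁ → Fib j b'
    target∈ same = trans (same-target-fibre (sym same)) β₁∈
    forth : Σ[ z ∈ Fin n ] (rel a z ≡ rel α₁ β₁ × rel z γ ≡ φ j g) → rel a γ ≡ rel α₁ β₁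
    forth (z , az , zγ) = trans (everywhere (source∈ az) (target∈ az) zγ) az
    back : rel a γ ≡ rel α₁ β₁ → Σ[ z ∈ Fin n ] (rel a z ≡ rel α₁ β₁ × rel z γ ≡ φ j g)
    back aγ with neighbour g (target∈ aγ)
    ... | z , γz , _ = z , trans (everywhere (source∈ aγ) (target∈ aγ) γz) aγ , fibre-sym γz

  R-identity : ∀ i j → R rel ι φ i j e
  R-identity i j with fibre-point i | fibre-point j
  ... | α , α∈ | β , β∈ = R-intro α∈ β∈ (fibre-identity β∈) refl

  R-closed : ∀ {i j g h} → R rel ι φ i j g → R rel ι φ i j h → R rel ι φ i j (g ∙ h)
  R-closed {i} {j} {g} {h} g∈R h∈R with fibre-point i | fibre-point j
  ... | α , α∈ | β , β∈ with neighbour g β∈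
  ... | β₁ , ββ₁ , _ with neighbour h (proj₂ (fibre-ends ββ₁))
  ... | β₂ , β₁β₂ , _ =
    R-intro α∈ β∈ (fibre-comp ββ₁ β₁β₂)
      (sym (trans (R-elim h∈R α∈ (proj₂ (fibre-ends ββ₁)) β₁β₂) (R-elim g∈R α∈ β∈ ββ₁)))

  -- For γ ∈ Ω_d and its g-neighbour γ₂, the path β → α → γ moves to a path
  -- β → x → γ₂; the step α → x lies in R_ba ⊆ R_da, which makes (α,γ) and
  -- (α,γ₂) of the same colour.
  R-exchange : ∀ a b d → (∀ t → R rel ι φ b a t → R rel ι φ d a t) →
               ∀ g → R rel ι φ b d g → R rel ι φ a d g
  R-exchange a b d R-ba⊆R-da g g∈R-bd with fibre-point a | fibre-point b | fibre-point d
  ... | α , α∈ | β , β∈ | γ , γ∈ with neighbour g γ∈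
  ... | γ₂ , γγ₂ , _ with transfer {z = α} (sym (R-elim g∈R-bd β∈ γ∈ γγ₂)) refl refl
  ... | x , βx , xγ₂ with φ-surjective a α x α∈ (trans (same-target-fibre (sym βx)) α∈)
  ... | t , αx = R-intro α∈ γ∈ γγ₂ (trans (sym xγ₂) x↔α)
    where
    γ₂∈ : Fib d γ₂
    γ₂∈ = proj₂ (fibre-ends γγ₂)
    t∈R-da : R rel ι φ d a t
    t∈R-da = R-ba⊆R-da t (R-intro β∈ α∈ αx (sym βx))
    x↔α : rel x γ₂ ≡ rel α γ₂
    x↔α = transpose γ₂ x γ₂ α (R-elim t∈R-da γ₂∈ α∈ αx)

-- A point i assigns to every other point x an involution
-- colour i x of G; the colouring is subject to the exchange law.  This is all
-- the combinatorics of a reduced Klein configuration retains.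

record KleinColouring (k : ℕ) : Set where
  field
    colour   : Fin k → Fin k → G
    colour≢e : ∀ i x → x ≢ i → colour i x ≢ e
    exchange : ∀ a b d → a ≢ b → b ≢ d → a ≢ d → colour a b ≡ colour a d → colour d b ≡ colour d a

  Beam : Fin k → G → Fin k → Set
  Beam i h x = x ≡ i ⊎ colour i x ≡ h

  IsLine : Incidence k
  IsLine ℓ = Σ[ i ∈ Fin k ] Σ[ j ∈ Fin k ] (j ≢ i × ℓ ≐ Beam i (colour i j))

  TwoColoured : Fin k → Set
  TwoColoured p = Σ[ y ∈ Fin k ] Σ[ z ∈ Fin k ] (y ≢ p × z ≢ p × colour p y ≢ colour p z)

-- The Klein colouring of a reduced configuration in which no R_ij is all of G:
-- colour i x generates R_xi, which has order 2.

module ReducedColouring {n m k : ℕ} (rel : Fin n → Fin n → Fin m) (cc : IsCoherentConfiguration rel)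
         (ι : Fin k → Fin m) (fi : IsFiberIndexing rel ι)
         (φ : Fin k → G → Fin m) (fs : IsFiberIsomorphisms rel ι φ)
         (reduced : ∀ i j → i ≢ j → Σ[ g ∈ G ] (g ≢ e × R rel ι φ i j g))
         (proper : ∀ i j → Σ[ g ∈ G ] ¬ R rel ι φ i j g) where
  open KleinStructure rel cc ι fi φ fs

  -- a subgroup of G containing an involution and missing some element has order 2
  R-order-2 : ∀ i j → i ≢ j → Σ[ h ∈ G ] (h ≢ e × R≡⟨ h ⟩ rel ι φ i j)
  R-order-2 i j i≢j with reduced i j i≢j | proper i j
  ... | h , h≢e , h∈R | g , g∉R = h , h≢e , λ x → mk⇔ (forth x) (back x)
    where
    back : ∀ x → x ≡ e ⊎ x ≡ h → R rel ι φ i j x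
    back x (inj₁ refl) = R-identity i j
    back x (inj₂ refl) = h∈R
    forth : ∀ x → R rel ι φ i j x → x ≡ e ⊎ x ≡ h
    forth x x∈R with x ≟G e | x ≟G h
    ... | yes x≡e | _ = inj₁ x≡e
    ... | no _ | yes x≡h = inj₂ x≡h
    ... | no x≢e | no x≢h with generated h x g h≢e x≢e (λ h≡x → x≢h (sym h≡x))
    ... | inj₁ refl = ⊥-elim (g∉R (R-identity i j))
    ... | inj₂ (inj₁ refl) = ⊥-elim (g∉R h∈R)
    ... | inj₂ (inj₂ (inj₁ refl)) = ⊥-elim (g∉R x∈R)
    ... | inj₂ (inj₂ (inj₂ refl)) = ⊥-elim (g∉R (R-closed h∈R x∈R))

  -- the colour of x seen from i: the generator of R_xi (irrelevant for x = i)
  colour : Fin k → Fin k → G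
  colour i x with x ≟ i
  ... | yes _ = e
  ... | no x≢i = proj₁ (R-order-2 x i x≢i)

  colour-spec : ∀ i x → x ≢ i → R≡⟨ colour i x ⟩ rel ι φ x i × colour i x ≢ e
  colour-spec i x x≢i with x ≟ i
  ... | yes x≡i = ⊥-elim (x≢i x≡i)
  ... | no x≢i' = proj₂ (proj₂ (R-order-2 x i x≢i')) , proj₁ (proj₂ (R-order-2 x i x≢i'))

  R-colour : ∀ {i x g} → x ≢ i → R rel ι φ x i g → g ≡ e ⊎ g ≡ colour i x
  R-colour {i} {x} {g} x≢i = ⇔to (proj₁ (colour-spec i x x≢i) g)

  R≡⟨⟩⇔colour : ∀ {h i x} → h ≢ e → x ≢ i → R≡⟨ h ⟩ rel ι φ x i ⇔ (colour i x ≡ h)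
  R≡⟨⟩⇔colour {h} {i} {x} h≢e x≢i = mk⇔ forth (λ { refl → proj₁ (colour-spec i x x≢i) })
    where
    forth : R≡⟨ h ⟩ rel ι φ x i → colour i x ≡ h
    forth R≡⟨h⟩ with R-colour x≢i (⇔from (R≡⟨h⟩ h) (inj₂ refl))
    ... | inj₁ h≡e = ⊥-elim (h≢e h≡e)
    ... | inj₂ h≡colour = sym h≡colour

  -- the exchange law, from R-exchange applied to R_ba = R_da
  exchange : ∀ a b d → a ≢ b → b ≢ d → a ≢ d → colour a b ≡ colour a d → colour d b ≡ colour d a
  exchange a b d a≢b b≢d a≢d same =
    nontrivial (R-colour a≢d (R-exchange a b d R-ba⊆R-da (colour d b) colour-db∈R))
    where
    colour-db∈R : R rel ι φ b d (colour d b)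
    colour-db∈R = ⇔from (proj₁ (colour-spec d b b≢d) (colour d b)) (inj₂ refl)
    R-ba⊆R-da : ∀ t → R rel ι φ b a t → R rel ι φ d a t
    R-ba⊆R-da t t∈R with R-colour (λ b≡a → a≢b (sym b≡a)) t∈R
    ... | inj₁ refl = R-identity d a
    ... | inj₂ refl = ⇔from (proj₁ (colour-spec a d (λ d≡a → a≢d (sym d≡a))) (colour a b)) (inj₂ same)
    nontrivial : colour d b ≡ e ⊎ colour d b ≡ colour d a → colour d b ≡ colour d a
    nontrivial (inj₁ db≡e) = ⊥-elim (proj₂ (colour-spec d b b≢d) db≡e)
    nontrivial (inj₂ db≡da) = db≡da

  klein-colouring : KleinColouring k
  klein-colouring = record
    { colour = colour
    ; colour≢e = λ i x x≢i → proj₂ (colour-spec i x x≢i)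
    ; exchange = exchange }

  open KleinColouring klein-colouring using (Beam; IsLine)

  line-points : ∀ {i h x} → h ≢ e → LinePt rel ι φ i h x ⇔ Beam i h x
  line-points {i} {h} {x} h≢e = mk⇔ (forth (x ≟ i)) (back (x ≟ i))
    where
    forth : Dec (x ≡ i) → LinePt rel ι φ i h x → Beam i h x
    forth _ (inj₁ x≡i) = inj₁ x≡i
    forth (yes x≡i) (inj₂ _) = inj₁ x≡i
    forth (no x≢i) (inj₂ R≡⟨h⟩) = inj₂ (⇔to (R≡⟨⟩⇔colour h≢e x≢i) R≡⟨h⟩)
    back : Dec (x ≡ i) → Beam i h x → LinePt rel ι φ i h x
    back _ (inj₁ x≡i) = inj₁ x≡i
    back (yes x≡i) (inj₂ _) = inj₁ x≡i
    back (no x≢i) (inj₂ colour≡h) = inj₂ (⇔from (R≡⟨⟩⇔colour h≢e x≢i) colour≡h)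

  lines : ∀ ℓ → 𝒢 rel ι φ ℓ ⇔ IsLine ℓ
  lines ℓ = mk⇔ forth back
    where
    forth : 𝒢 rel ι φ ℓ → IsLine ℓ
    forth (i , h , h≢e , (j , j≢i , R≡⟨h⟩) , ℓ≐) with ⇔to (R≡⟨⟩⇔colour h≢e j≢i) R≡⟨h⟩
    ... | refl = i , j , j≢i , λ x → mk⇔ (λ ℓx → ⇔to (line-points h≢e) (⇔to (ℓ≐ x) ℓx))
                                         (λ bx → ⇔from (ℓ≐ x) (⇔from (line-points h≢e) bx))
    back : IsLine ℓ → 𝒢 rel ι φ ℓ
    back (i , j , j≢i , ℓ≐) =
      i , colour i j , colour≢e , (j , j≢i , proj₁ (colour-spec i j j≢i)) ,
      λ x → mk⇔ (λ ℓx → ⇔from (line-points colour≢e) (⇔to (ℓ≐ x) ℓx))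
                (λ px → ⇔from (ℓ≐ x) (⇔to (line-points colour≢e) px))
      where
      colour≢e : colour i j ≢ e
      colour≢e = proj₂ (colour-spec i j j≢i)

Distinct3 : {A : Set} → A → A → A → Set
Distinct3 x y z = x ≢ y × x ≢ z × y ≢ z

module Collinearity {k : ℕ} (K : KleinColouring k) where
  open KleinColouring K

  Col : Fin k → Fin k → Fin k → Set
  Col x y z = Distinct3 x y z × colour x y ≡ colour x z

  -- collinearity is invariant under all permutations, generated by these two
  Col-swap : ∀ {x y z} → Col x y z → Col x z y
  Col-swap ((x≢y , x≢z , y≢z) , same) = (x≢z , x≢y , ≢-sym y≢z) , sym same

  Col-reverse : ∀ {x y z} → Col x y z → Col z y x
  Col-reverse {x} {y} {z} ((x≢y , x≢z , y≢z) , same) =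
    (≢-sym y≢z , ≢-sym x≢z , ≢-sym x≢y) , exchange x y z x≢y y≢z x≢z same

  Col-rotate : ∀ {x y z} → Col x y z → Col z x y
  Col-rotate col = Col-swap (Col-reverse col)

  Col-flip : ∀ {x y z} → Col x y z → Col y x z
  Col-flip col = Col-reverse (Col-rotate col)

  Col-rotate⁻¹ : ∀ {x y z} → Col x y z → Col y z x
  Col-rotate⁻¹ col = Col-swap (Col-flip col)

  Col-extend : ∀ {x s t q} → Col x s t → Col q s t → x ≢ q → Col x s q
  Col-extend {x} {s} {t} {q} xst qst x≢q =
    let ((x≢s , x≢t , s≢t) , _) = xst
        ((q≢s , q≢t , _) , _) = qst
        seen-from-t : colour t x ≡ colour t q
        seen-from-t = trans (sym (proj₂ (Col-reverse xst))) (proj₂ (Col-reverse qst))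
        txq : Col t x q
        txq = (≢-sym x≢t , ≢-sym q≢t , x≢q) , seen-from-t
    in (x≢s , x≢q , ≢-sym q≢s) , trans (proj₂ xst) (proj₂ (Col-flip txq))

  beam-through : ∀ {i j x} → j ≢ i → Beam i (colour i j) x ⇔ (x ≡ i ⊎ x ≡ j ⊎ Col i j x)
  beam-through {i} {j} {x} j≢i = mk⇔ (forth (x ≟ i) (x ≟ j)) back
    where
    forth : Dec (x ≡ i) → Dec (x ≡ j) → Beam i (colour i j) x → x ≡ i ⊎ x ≡ j ⊎ Col i j x
    forth _ _ (inj₁ x≡i) = inj₁ x≡i
    forth (yes x≡i) _ (inj₂ _) = inj₁ x≡i
    forth (no _) (yes x≡j) (inj₂ _) = inj₂ (inj₁ x≡j)
    forth (no x≢i) (no x≢j) (inj₂ same) = inj₂ (inj₂ ((≢-sym j≢i , ≢-sym x≢i , ≢-sym x≢j) , sym same))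
    back : x ≡ i ⊎ x ≡ j ⊎ Col i j x → Beam i (colour i j) x
    back (inj₁ x≡i) = inj₁ x≡i
    back (inj₂ (inj₁ refl)) = inj₂ refl
    back (inj₂ (inj₂ (_ , same))) = inj₂ (sym same)

  -- Pigeonhole at a point: x sees four other points in only three colours.
  pigeonhole-at : ∀ x y₁ y₂ y₃ y₄ → y₁ ≢ x → y₂ ≢ x → y₃ ≢ x → y₄ ≢ x →
    y₁ ≢ y₂ → y₁ ≢ y₃ → y₁ ≢ y₄ → y₂ ≢ y₃ → y₂ ≢ y₄ → y₃ ≢ y₄ →
    Col x y₁ y₂ ⊎ Col x y₁ y₃ ⊎ Col x y₁ y₄ ⊎ Col x y₂ y₃ ⊎ Col x y₂ y₄ ⊎ Col x y₃ y₄
  pigeonhole-at x y₁ y₂ y₃ y₄ y₁≢x y₂≢x y₃≢x y₄≢x y₁≢y₂ y₁≢y₃ y₁≢y₄ y₂≢y₃ y₂≢y₄ y₃≢y₄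
    with three-involutions (colour x y₁) (colour x y₂) (colour x y₃) (colour x y₄)
           (colour≢e x y₁ y₁≢x) (colour≢e x y₂ y₂≢x) (colour≢e x y₃ y₃≢x) (colour≢e x y₄ y₄≢x)
  ... | inj₁ same = inj₁ ((≢-sym y₁≢x , ≢-sym y₂≢x , y₁≢y₂) , same)
  ... | inj₂ (inj₁ same) = inj₂ (inj₁ ((≢-sym y₁≢x , ≢-sym y₃≢x , y₁≢y₃) , same))
  ... | inj₂ (inj₂ (inj₁ same)) = inj₂ (inj₂ (inj₁ ((≢-sym y₁≢x , ≢-sym y₄≢x , y₁≢y₄) , same)))
  ... | inj₂ (inj₂ (inj₂ (inj₁ same))) =
    inj₂ (inj₂ (inj₂ (inj₁ ((≢-sym y₂≢x , ≢-sym y₃≢x , y₂≢y₃) , same))))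
  ... | inj₂ (inj₂ (inj₂ (inj₂ (inj₁ same)))) =
    inj₂ (inj₂ (inj₂ (inj₂ (inj₁ ((≢-sym y₂≢x , ≢-sym y₄≢x , y₂≢y₄) , same)))))
  ... | inj₂ (inj₂ (inj₂ (inj₂ (inj₂ same)))) =
    inj₂ (inj₂ (inj₂ (inj₂ (inj₂ ((≢-sym y₃≢x , ≢-sym y₄≢x , y₃≢y₄) , same)))))

module ThinLines {k : ℕ} (K : KleinColouring k) (two-colours : ∀ p → KleinColouring.TwoColoured K p) where
  open KleinColouring K
  open Collinearity K

  off-line : ∀ x h → Σ[ q ∈ Fin k ] (q ≢ x × colour x q ≢ h)
  off-line x h with two-colours x
  ... | y , z , y≢x , z≢x , y≁z with colour x y ≟G h
  ... | yes xy≡h = z , z≢x , λ xz≡h → y≁z (trans xy≡h (sym xz≡h))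
  ... | no xy≢h = y , y≢x , xy≢h

  -- A point q off the line through x, y, z, w would see two of these four
  -- points in one colour; then q would lie on the line.
  at-most-three : ∀ {x y z w} → Col x y z → Col x y w → z ≢ w → ⊥
  at-most-three {x} {y} {z} {w} xyz@((x≢y , x≢z , y≢z) , _) xyw@((_ , x≢w , y≢w) , _) z≢w =
    refute (off-line x (colour x y))
    where
    xzw : Col x z w
    xzw = (x≢z , x≢w , z≢w) , trans (sym (proj₂ xyz)) (proj₂ xyw)
    refute : Σ[ q ∈ Fin k ] (q ≢ x × colour x q ≢ colour x y) → ⊥
    refute (q , q≢x , xq≢xy) =
      contradict (pigeonhole-at q x y z w x≢q (≢q refl) (≢q (sym (proj₂ xyz))) (≢q (sym (proj₂ xyw)))
                                x≢y x≢z x≢w y≢z y≢w z≢w)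
      where
      x≢q : x ≢ q
      x≢q = ≢-sym q≢x
      ≢q : ∀ {t} → colour x t ≡ colour x y → t ≢ q
      ≢q on-line refl = xq≢xy on-line
      through-x : ∀ {t} → colour x t ≡ colour x y → Col q x t → ⊥
      through-x xt≡xy qxt = xq≢xy (trans (proj₂ (Col-flip qxt)) xt≡xy)
      avoiding-x : ∀ {s t} → colour x s ≡ colour x y → Col x s t → Col q s t → ⊥
      avoiding-x xs≡xy xst qst = xq≢xy (trans (sym (proj₂ (Col-extend xst qst x≢q))) xs≡xy)
      contradict : Col q x y ⊎ Col q x z ⊎ Col q x w ⊎ Col q y z ⊎ Col q y w ⊎ Col q z w → ⊥
      contradict (inj₁ qxy) = through-x refl qxy
      contradict (inj₂ (inj₁ qxz)) = through-x (sym (proj₂ xyz)) qxz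
      contradict (inj₂ (inj₂ (inj₁ qxw))) = through-x (sym (proj₂ xyw)) qxw
      contradict (inj₂ (inj₂ (inj₂ (inj₁ qyz)))) = avoiding-x refl xyz qyz
      contradict (inj₂ (inj₂ (inj₂ (inj₂ (inj₁ qyw))))) = avoiding-x refl xyw qyw
      contradict (inj₂ (inj₂ (inj₂ (inj₂ (inj₂ qzw))))) = avoiding-x (sym (proj₂ xyz)) xzw qzw

  third-unique : ∀ {x y z w} → Col x y z → Col x y w → z ≡ w
  third-unique {z = z} {w} xyz xyw with z ≟ w
  ... | yes z≡w = z≡w
  ... | no z≢w = ⊥-elim (at-most-three xyz xyw z≢w)

Triple : ℕ → Set
Triple p = Fin p × Fin p × Fin p

orderings : ∀ {p} → Triple p → List (Triple p)
orderings (a , b , c) = (a , b , c) ∷ (a , c , b) ∷ (b , a , c) ∷ (b , c , a) ∷ (c , a , b) ∷ (c , b , a) ∷ []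

ordered : ∀ {p} → List (Triple p) → List (Triple p)
ordered = concatMap orderings

_∈ₚ?_ : ∀ {p} (u : Fin p) (N : List (Fin p)) → Dec (u ∈ N)
u ∈ₚ? N = Any.any? (u ≟_) N

_≟ₗ_ : ∀ {p} (N N' : List (Fin p)) → Dec (N ≡ N')
_≟ₗ_ = List.≡-dec _≟_

_∈ₗ?_ : ∀ {p} (N : List (Fin p)) (M : List (List (Fin p))) → Dec (N ∈ M)
N ∈ₗ? M = Any.any? (N ≟ₗ_) M

_∈ₜ?_ : ∀ {p} (t : Triple p) (T : List (Triple p)) → Dec (t ∈ T)
t ∈ₜ? T = Any.any? (≡-dec _≟_ (≡-dec _≟_ _≟_) t) T

join : ∀ {p} → List (List (Fin p)) → Fin p → Fin p → List (Fin p)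
join [] u v = []
join (N ∷ M) u v = if ⌊ u ∈ₚ? N ⌋ ∧ ⌊ v ∈ₚ? N ⌋ then N else join M u v

-- The lines of M are determined by its three-point lines T: the join of two
-- points consists of them and the third points of the triples through them.
JoinTable : ∀ {p} → List (List (Fin p)) → List (Triple p) → Set
JoinTable {p} M T = ∀ (u v w : Fin p) → u ≢ v →
  w ∈ join M u v ⇔ (w ≡ u ⊎ w ≡ v ⊎ (u , v , w) ∈ ordered T)

joinTable? : ∀ {p} (M : List (List (Fin p))) (T : List (Triple p)) → Dec (JoinTable M T)
joinTable? M T = all? λ u → all? λ v → all? λ w → ¬? (u ≟ v) →-dec
  ⇔-dec (w ∈ₚ? join M u v) ((w ≟ u) ⊎-dec ((w ≟ v) ⊎-dec ((u , v , w) ∈ₜ? ordered T)))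
  where
  ⇔-dec : ∀ {A B : Set} → Dec A → Dec B → Dec (A ⇔ B)
  ⇔-dec (yes a) (yes b) = yes (mk⇔ (λ _ → b) (λ _ → a))
  ⇔-dec (no ¬a) (no ¬b) = yes (mk⇔ (λ a → ⊥-elim (¬a a)) (λ b → ⊥-elim (¬b b)))
  ⇔-dec (yes a) (no ¬b) = no λ a⇔b → ¬b (⇔to a⇔b a)
  ⇔-dec (no ¬a) (yes b) = no λ a⇔b → ¬a (⇔from a⇔b b)

JoinsListed : ∀ {p} → List (List (Fin p)) → Set
JoinsListed {p} M = ∀ (u v : Fin p) → u ≢ v → join M u v ∈ M

joinsListed? : ∀ {p} (M : List (List (Fin p))) → Dec (JoinsListed M)
joinsListed? M = all? λ u → all? λ v → ¬? (u ≟ v) →-dec (join M u v ∈ₗ? M)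

ListedAreJoins : ∀ {p} → List (List (Fin p)) → Set
ListedAreJoins {p} M = All (λ N → Σ[ u ∈ Fin p ] Σ[ v ∈ Fin p ] (u ≢ v × N ≡ join M u v)) M

listedAreJoins? : ∀ {p} (M : List (List (Fin p))) → Dec (ListedAreJoins M)
listedAreJoins? M = All.all? (λ N → any? λ u → any? λ v → ¬? (u ≟ v) ×-dec (N ≟ₗ join M u v)) M

record Model (p : ℕ) : Set where
  field
    lines          : List (List (Fin p))
    triples        : List (Triple p)
    join-table     : JoinTable lines triples
    joins-listed   : JoinsListed lines
    listed-joins   : ListedAreJoins lines

checked-model : ∀ {p} (M : List (List (Fin p))) (T : List (Triple p)) →
  {True (joinTable? M T)} → {True (joinsListed? M)} → {True (listedAreJoins? M)} → Model p
checked-model M T {table} {listed} {joins} = record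
  { lines = M ; triples = T ; join-table = toWitness table
  ; joins-listed = toWitness listed ; listed-joins = toWitness joins }

TriplesDetermined : ∀ {p} → List (Triple p) → Set
TriplesDetermined {p} T = ∀ (u v w : Fin p) → Distinct3 u v w → (u , v , w) ∉ ordered T →
  Σ[ z ∈ Fin p ] (((u , v , z) ∈ ordered T × z ≢ w) ⊎ ((u , w , z) ∈ ordered T × z ≢ v) ⊎
                  ((v , w , z) ∈ ordered T × z ≢ u))

triplesDetermined? : ∀ {p} (T : List (Triple p)) → Dec (TriplesDetermined T)
triplesDetermined? T = all? λ u → all? λ v → all? λ w →
  (¬? (u ≟ v) ×-dec (¬? (u ≟ w) ×-dec ¬? (v ≟ w))) →-dec (¬? ((u , v , w) ∈ₜ? ordered T) →-dec
    any? λ z → (((u , v , z) ∈ₜ? ordered T) ×-dec ¬? (z ≟ w)) ⊎-dec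
               ((((u , w , z) ∈ₜ? ordered T) ×-dec ¬? (z ≟ v)) ⊎-dec
                (((v , w , z) ∈ₜ? ordered T) ×-dec ¬? (z ≟ u))))

-- Recognising a model: if the points of a Klein colouring are listed without
-- repetition, and the listed triples of a model are exactly the collinear
-- triples, then the lines of the colouring are those of the model.

module Recognition {k : ℕ} (K : KleinColouring k) (Line : Incidence k)
    (lines : ∀ ℓ → Line ℓ ⇔ KleinColouring.IsLine K ℓ)
    {p : ℕ} (𝕄 : Model p) (ps : Vec (Fin k) p) (distinct : Unique ps) (complete : ∀ x → x ∈ᵥ ps) where
  open KleinColouring K
  open Collinearity K
  open Model 𝕄 renaming (lines to model-lines)

  point : Fin p → Fin k
  point = lookup ps

  label : Fin k → Fin p
  label x = Anyᵥ.index (complete x)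

  point-label : ∀ x → point (label x) ≡ x
  point-label x = sym (lookup-index (complete x))

  label-point : ∀ u → label (point u) ≡ u
  label-point u = lookup-injective distinct _ _ (point-label (point u))

  labelling : Fin k ↔ Fin p
  labelling = mk↔ₛ′ label point label-point point-label

  label-injective : ∀ {x y} → label x ≡ label y → x ≡ y
  label-injective {x} {y} same = trans (sym (point-label x)) (trans (cong point same) (point-label y))

  point-injective : ∀ {u v} → u ≢ v → point u ≢ point v
  point-injective u≢v same = u≢v (lookup-injective distinct _ _ same)

  ColTriple : Triple p → Set
  ColTriple (u , v , w) = Col (point u) (point v) (point w)

  Col-relabel : ∀ {i j x} → Col i j x ⇔ ColTriple (label i , label j , label x)
  Col-relabel {i} {j} {x} rewrite point-label i | point-label j | point-label x = mk⇔ id id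

  collinear-orderings : All ColTriple triples → All ColTriple (ordered triples)
  collinear-orderings collinear = concat⁺ (map⁺ (All.map (λ col → col ∷ Col-swap col ∷ Col-flip col ∷
    Col-rotate⁻¹ col ∷ Col-rotate col ∷ Col-reverse col ∷ []) collinear))

  determined-non-collinear : (∀ {x y z w} → Col x y z → Col x y w → z ≢ w → ⊥) →
    TriplesDetermined triples → All ColTriple triples →
    ∀ u v w → Distinct3 u v w → (u , v , w) ∉ ordered triples → ¬ ColTriple (u , v , w)
  determined-non-collinear at-most-three determined collinear u v w distinct3 unlisted col =
    refute (determined u v w distinct3 unlisted)
    where
    on-line : ∀ {t} → t ∈ ordered triples → ColTriple t
    on-line = All.lookup (collinear-orderings collinear)
    refute : Σ[ z ∈ Fin p ] (((u , v , z) ∈ ordered triples × z ≢ w) ⊎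
                             ((u , w , z) ∈ ordered triples × z ≢ v) ⊎
                             ((v , w , z) ∈ ordered triples × z ≢ u)) → ⊥
    refute (z , inj₁ (uvz , z≢w)) = at-most-three col (on-line uvz) (point-injective (≢-sym z≢w))
    refute (z , inj₂ (inj₁ (uwz , z≢v))) =
      at-most-three (Col-swap col) (on-line uwz) (point-injective (≢-sym z≢v))
    refute (z , inj₂ (inj₂ (vwz , z≢u))) =
      at-most-three (Col-rotate⁻¹ col) (on-line vwz) (point-injective (≢-sym z≢u))

  module _ (collinear : All ColTriple triples)
           (non-collinear : ∀ u v w → Distinct3 u v w → (u , v , w) ∉ ordered triples →
                            ¬ ColTriple (u , v , w)) where

    Col⇔ordered : ∀ t → ColTriple t ⇔ (t ∈ ordered triples)
    Col⇔ordered t@(u , v , w) = mk⇔ forth (All.lookup (collinear-orderings collinear))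
      where
      forth : ColTriple t → t ∈ ordered triples
      forth col@((u≢v , u≢w , v≢w) , _) with t ∈ₜ? ordered triples
      ... | yes listed = listed
      ... | no unlisted = ⊥-elim (non-collinear u v w ((λ { refl → u≢v refl }) , (λ { refl → u≢w refl }) ,
                                                        (λ { refl → v≢w refl })) unlisted col)

    joins-agree : ∀ {i j x} → j ≢ i → Beam i (colour i j) x ⇔ (label x ∈ join model-lines (label i) (label j))
    joins-agree {i} {j} {x} j≢i = mk⇔
      (λ bx → ⇔from table (Sum.map (cong label) (Sum.map (cong label) (⇔to (Col⇔ordered _) ∘ ⇔to Col-relabel))
                                    (⇔to (beam-through j≢i) bx)))
      (λ jx → ⇔from (beam-through j≢i) (Sum.map label-injective (Sum.map label-injective
                                          (⇔from Col-relabel ∘ ⇔from (Col⇔ordered _))) (⇔to table jx)))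
      where
      table : label x ∈ join model-lines (label i) (label j) ⇔
              (label x ≡ label i ⊎ label x ≡ label j ⊎ (label i , label j , label x) ∈ ordered triples)
      table = join-table (label i) (label j) (label x) (λ same → j≢i (sym (label-injective same)))

    isomorphic : IsomorphicTo Line p model-lines
    isomorphic = labelling , lines-to-model , model-to-lines
      where
      lines-to-model : ∀ ℓ → Line ℓ → Σ[ N ∈ List (Fin p) ] (N ∈ model-lines × (∀ x → ℓ x ⇔ (label x ∈ N)))
      lines-to-model ℓ ℓ-line with ⇔to (lines ℓ) ℓ-line
      ... | i , j , j≢i , ℓ≐ =
        join model-lines (label i) (label j) ,
        joins-listed (label i) (label j) (λ same → j≢i (sym (label-injective same))) ,
        λ x → mk⇔ (⇔to (joins-agree j≢i) ∘ ⇔to (ℓ≐ x)) (⇔from (ℓ≐ x) ∘ ⇔from (joins-agree j≢i))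
      model-to-lines : ∀ N → N ∈ model-lines → Σ[ ℓ ∈ (Fin k → Set) ] (Line ℓ × (∀ x → ℓ x ⇔ (label x ∈ N)))
      model-to-lines N listed with All.lookup listed-joins listed
      ... | u , v , u≢v , refl =
        Beam (point u) (colour (point u) (point v)) ,
        ⇔from (lines _) (point u , point v , point-v≢point-u , λ x → mk⇔ id id) ,
        λ x → subst₂ (λ a b → Beam (point u) (colour (point u) (point v)) x ⇔ (label x ∈ join model-lines a b))
                     (label-point u) (label-point v) (joins-agree point-v≢point-u)
        where
        point-v≢point-u : point v ≢ point u
        point-v≢point-u = point-injective (≢-sym u≢v)

UniqueJoins : ∀ {p} → List (List (Fin p)) → Set
UniqueJoins {p} M = ∀ (u v : Fin p) → u ≢ v →
  join M u v ∈ M × u ∈ join M u v × v ∈ join M u v × All (λ N → u ∈ N → v ∈ N → N ≡ join M u v) M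

uniqueJoins? : ∀ {p} (M : List (List (Fin p))) → Dec (UniqueJoins M)
uniqueJoins? M = all? λ u → all? λ v → ¬? (u ≟ v) →-dec
  ((join M u v ∈ₗ? M) ×-dec ((u ∈ₚ? join M u v) ×-dec ((v ∈ₚ? join M u v) ×-dec
    All.all? (λ N → (u ∈ₚ? N) →-dec ((v ∈ₚ? N) →-dec (N ≟ₗ join M u v))) M)))

Meets : ∀ {p} → List (List (Fin p)) → Set
Meets {p} M = All (λ N → All (λ N' → N ≢ N' →
  Σ[ u ∈ Fin p ] (u ∈ N × u ∈ N' × (∀ w → ¬ (w ≢ u × w ∈ N × w ∈ N')))) M) M

meets? : ∀ {p} (M : List (List (Fin p))) → Dec (Meets M)
meets? M = All.all? (λ N → All.all? (λ N' → ¬? (N ≟ₗ N') →-dec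
  any? (λ u → (u ∈ₚ? N) ×-dec ((u ∈ₚ? N') ×-dec
    all? (λ w → ¬? (¬? (w ≟ u) ×-dec ((w ∈ₚ? N) ×-dec (w ∈ₚ? N'))))))) M) M

Disjoint-lists : ∀ {p} → List (Fin p) → List (Fin p) → Set
Disjoint-lists {p} N N' = ∀ (w : Fin p) → ¬ (w ∈ N × w ∈ N')

disjoint? : ∀ {p} (N N' : List (Fin p)) → Dec (Disjoint-lists N N')
disjoint? N N' = all? λ w → ¬? ((w ∈ₚ? N) ×-dec (w ∈ₚ? N'))

parallel : ∀ {p} → List (List (Fin p)) → List (Fin p) → Fin p → List (Fin p)
parallel [] N u = []
parallel (N' ∷ M) N u = if ⌊ u ∈ₚ? N' ⌋ ∧ ⌊ disjoint? N N' ⌋ then N' else parallel M N u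

Parallels : ∀ {p} → List (List (Fin p)) → Set
Parallels {p} M = All (λ N → ∀ (u : Fin p) → u ∉ N →
  parallel M N u ∈ M × u ∈ parallel M N u × Disjoint-lists N (parallel M N u) ×
  All (λ N' → u ∈ N' → Disjoint-lists N N' → N' ≡ parallel M N u) M) M

parallels? : ∀ {p} (M : List (List (Fin p))) → Dec (Parallels M)
parallels? M = All.all? (λ N → all? λ u → ¬? (u ∈ₚ? N) →-dec
  ((parallel M N u ∈ₗ? M) ×-dec ((u ∈ₚ? parallel M N u) ×-dec (disjoint? N (parallel M N u) ×-dec
    All.all? (λ N' → (u ∈ₚ? N') →-dec (disjoint? N N' →-dec (N' ≟ₗ parallel M N u))) M)))) M

NoLineThrough : ∀ {p} → List (List (Fin p)) → Fin p → Fin p → Fin p → Set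
NoLineThrough M a b c = All (λ N → ¬ (a ∈ N × b ∈ N × c ∈ N)) M

noLineThrough? : ∀ {p} (M : List (List (Fin p))) a b c → Dec (NoLineThrough M a b c)
noLineThrough? M a b c = All.all? (λ N → ¬? ((a ∈ₚ? N) ×-dec ((b ∈ₚ? N) ×-dec (c ∈ₚ? N)))) M

Lines-of-3 : ∀ {p} → List (List (Fin p)) → Set
Lines-of-3 {p} M = All (λ N → Σ[ a ∈ Fin p ] Σ[ b ∈ Fin p ] Σ[ c ∈ Fin p ]
  (Distinct3 a b c × N ≡ a ∷ b ∷ c ∷ [])) M

lines-of-3? : ∀ {p} (M : List (List (Fin p))) → Dec (Lines-of-3 M)
lines-of-3? M = All.all? (λ N → any? λ a → any? λ b → any? λ c →
  (¬? (a ≟ b) ×-dec (¬? (a ≟ c) ×-dec ¬? (b ≟ c))) ×-dec (N ≟ₗ (a ∷ b ∷ c ∷ []))) M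

Lines-of-2 : ∀ {p} → List (List (Fin p)) → Set
Lines-of-2 {p} M = All (λ N → Σ[ a ∈ Fin p ] Σ[ b ∈ Fin p ] (a ≢ b × N ≡ a ∷ b ∷ [])) M

lines-of-2? : ∀ {p} (M : List (List (Fin p))) → Dec (Lines-of-2 M)
lines-of-2? M = All.all? (λ N → any? λ a → any? λ b → ¬? (a ≟ b) ×-dec (N ≟ₗ (a ∷ b ∷ []))) M

module Transport {k p : ℕ} (Line : Incidence k) (M : List (List (Fin p))) (iso : IsomorphicTo Line p M) where
  open Inverse (proj₁ iso) renaming (to to label; from to point)

  lines-to-model : ∀ ℓ → Line ℓ → Σ[ N ∈ List (Fin p) ] (N ∈ M × (∀ x → ℓ x ⇔ (label x ∈ N)))
  lines-to-model = proj₁ (proj₂ iso)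

  model-to-lines : ∀ N → N ∈ M → Σ[ ℓ ∈ (Fin k → Set) ] (Line ℓ × (∀ x → ℓ x ⇔ (label x ∈ N)))
  model-to-lines = proj₂ (proj₂ iso)

  label-point : ∀ u → label (point u) ≡ u
  label-point = strictlyInverseˡ

  point-label : ∀ x → point (label x) ≡ x
  point-label = strictlyInverseʳ

  label-injective : ∀ {x y} → label x ≡ label y → x ≡ y
  label-injective {x} {y} same = trans (sym (point-label x)) (trans (cong point same) (point-label y))

  size : k ≤ p
  size = injective⇒≤ label-injective

  point-injective : ∀ {u v} → u ≢ v → point u ≢ point v
  point-injective u≢v same = u≢v (trans (sym (label-point _)) (trans (cong label same) (label-point _)))

  ∈-point : ∀ {u N} → u ∈ N → label (point u) ∈ N
  ∈-point {u} {N} u∈N = subst (_∈ N) (sym (label-point u)) u∈N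

  ≐-from-list : ∀ {ℓ ℓ' N} → (∀ x → ℓ x ⇔ (label x ∈ N)) → (∀ x → ℓ' x ⇔ (label x ∈ N)) → ℓ ≐ ℓ'
  ≐-from-list ℓ≐N ℓ'≐N x = mk⇔ (⇔from (ℓ'≐N x) ∘ ⇔to (ℓ≐N x)) (⇔from (ℓ≐N x) ∘ ⇔to (ℓ'≐N x))

  unique-join : UniqueJoins M → UniqueJoin Line
  unique-join joins x y x≢y with joins (label x) (label y) (λ same → x≢y (label-injective same))
  ... | listed , x∈ , y∈ , unique with model-to-lines _ listed
  ... | ℓ , ℓ-line , ℓ≐ = ℓ , ℓ-line , ⇔from (ℓ≐ x) x∈ , ⇔from (ℓ≐ y) y∈ , through-x-y
    where
    through-x-y : ∀ ℓ' → Line ℓ' → ℓ' x → ℓ' y → ℓ' ≐ ℓ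
    through-x-y ℓ' ℓ'-line ℓ'x ℓ'y with lines-to-model ℓ' ℓ'-line
    ... | N' , listed' , ℓ'≐ with All.lookup unique listed' (⇔to (ℓ'≐ x) ℓ'x) (⇔to (ℓ'≐ y) ℓ'y)
    ... | refl = ≐-from-list ℓ'≐ ℓ≐

  not-collinear : ∀ {u v w} → NoLineThrough M u v w → ¬ Collinear Line (point u) (point v) (point w)
  not-collinear none (ℓ , ℓ-line , ℓu , ℓv , ℓw) with lines-to-model ℓ ℓ-line
  ... | N , listed , ℓ≐ = All.lookup none listed
        (subst (_∈ N) (label-point _) (⇔to (ℓ≐ _) ℓu) , subst (_∈ N) (label-point _) (⇔to (ℓ≐ _) ℓv) ,
         subst (_∈ N) (label-point _) (⇔to (ℓ≐ _) ℓw))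

  to-point : ∀ {x u} → label x ≡ u → x ≡ point u
  to-point {x} same = trans (sym (point-label x)) (cong point same)

  from-point : ∀ {x u} → x ≡ point u → label x ≡ u
  from-point {x} {u} refl = label-point u

  projective : UniqueJoins M → Meets M → Lines-of-3 M →
               ∀ a b c d → Distinct3 a b c → a ≢ d → b ≢ d → c ≢ d →
               NoLineThrough M a b c → NoLineThrough M a b d →
               NoLineThrough M a c d → NoLineThrough M b c d →
               IsProjectivePlaneOfOrder2 Line
  projective joins meet size3 a b c d (a≢b , a≢c , b≢c) a≢d b≢d c≢d abc abd acd bcd = record
    { join = unique-join joins ; meet = meet-point ; order2 = order2
    ; quadrangle = point a , point b , point c , point d ,
        point-injective a≢b , point-injective a≢c , point-injective a≢d ,
        point-injective b≢c , point-injective b≢d , point-injective c≢d ,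
        not-collinear abc , not-collinear abd , not-collinear acd , not-collinear bcd }
    where
    meet-point : ∀ ℓ ℓ' → Line ℓ → Line ℓ' → ¬ (ℓ ≐ ℓ') →
                 Σ[ x ∈ Fin k ] (ℓ x × ℓ' x × (∀ y → ℓ y → ℓ' y → y ≡ x))
    meet-point ℓ ℓ' ℓ-line ℓ'-line ℓ≠ℓ' with lines-to-model ℓ ℓ-line | lines-to-model ℓ' ℓ'-line
    ... | N , listed , ℓ≐ | N' , listed' , ℓ'≐
      with All.lookup (All.lookup meet listed) listed' (λ { refl → ℓ≠ℓ' (≐-from-list ℓ≐ ℓ'≐) })
    ... | u , u∈N , u∈N' , only-u =
      point u , ⇔from (ℓ≐ (point u)) (∈-point u∈N) , ⇔from (ℓ'≐ (point u)) (∈-point u∈N') ,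
      λ y ℓy ℓ'y → only (⇔to (ℓ≐ y) ℓy) (⇔to (ℓ'≐ y) ℓ'y)
      where
      only : ∀ {y} → label y ∈ N → label y ∈ N' → y ≡ point u
      only {y} y∈N y∈N' with label y ≟ u
      ... | yes same = to-point same
      ... | no differ = ⊥-elim (only-u (label y) (differ , y∈N , y∈N'))
    order2 : ∀ ℓ → Line ℓ → HasExactly3 ℓ
    order2 ℓ ℓ-line with lines-to-model ℓ ℓ-line
    ... | N , listed , ℓ≐ with All.lookup size3 listed
    ... | u , v , w , (u≢v , u≢w , v≢w) , refl =
      point u , point v , point w , point-injective u≢v , point-injective u≢w , point-injective v≢w ,
      λ x → mk⇔ (forth ∘ ⇔to (ℓ≐ x)) (⇔from (ℓ≐ x) ∘ back)
      where
      forth : ∀ {x} → label x ∈ u ∷ v ∷ w ∷ [] → x ≡ point u ⊎ x ≡ point v ⊎ x ≡ point w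
      forth (here same) = inj₁ (to-point same)
      forth (there (here same)) = inj₂ (inj₁ (to-point same))
      forth (there (there (here same))) = inj₂ (inj₂ (to-point same))
      back : ∀ {x} → x ≡ point u ⊎ x ≡ point v ⊎ x ≡ point w → label x ∈ u ∷ v ∷ w ∷ []
      back (inj₁ same) = here (from-point same)
      back (inj₂ (inj₁ same)) = there (here (from-point same))
      back (inj₂ (inj₂ same)) = there (there (here (from-point same)))

  affine : UniqueJoins M → Parallels M → Lines-of-2 M →
           ∀ a b c → Distinct3 a b c → NoLineThrough M a b c → IsAffinePlaneOfOrder2 Line
  affine joins parallels size2 a b c (a≢b , a≢c , b≢c) abc = record
    { join = unique-join joins ; parallel = parallel-line ; order2 = order2
    ; triangle = point a , point b , point c ,
        point-injective a≢b , point-injective a≢c , point-injective b≢c , not-collinear abc }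
    where
    parallel-line : ∀ ℓ x → Line ℓ → ¬ ℓ x →
      Σ[ ℓ' ∈ (Fin k → Set) ] (Line ℓ' × ℓ' x × Disjoint ℓ ℓ' ×
        (∀ ℓ'' → Line ℓ'' → ℓ'' x → Disjoint ℓ ℓ'' → ℓ'' ≐ ℓ'))
    parallel-line ℓ x ℓ-line x∉ℓ with lines-to-model ℓ ℓ-line
    ... | N , listed , ℓ≐ with All.lookup parallels listed (label x) (x∉ℓ ∘ ⇔from (ℓ≐ x))
    ... | listed' , x∈ , disjoint , unique with model-to-lines _ listed'
    ... | ℓ' , ℓ'-line , ℓ'≐ =
      ℓ' , ℓ'-line , ⇔from (ℓ'≐ x) x∈ ,
      (λ z ℓz ℓ'z → disjoint (label z) (⇔to (ℓ≐ z) ℓz , ⇔to (ℓ'≐ z) ℓ'z)) , only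
      where
      only : ∀ ℓ'' → Line ℓ'' → ℓ'' x → Disjoint ℓ ℓ'' → ℓ'' ≐ ℓ'
      only ℓ'' ℓ''-line ℓ''x disjoint'' with lines-to-model ℓ'' ℓ''-line
      ... | N'' , listed'' , ℓ''≐ with All.lookup unique listed'' (⇔to (ℓ''≐ x) ℓ''x)
               (λ w (w∈N , w∈N'') → disjoint'' (point w) (⇔from (ℓ≐ (point w)) (∈-point w∈N))
                                                          (⇔from (ℓ''≐ (point w)) (∈-point w∈N'')))
      ... | refl = ≐-from-list ℓ''≐ ℓ'≐
    order2 : ∀ ℓ → Line ℓ → HasExactly2 ℓ
    order2 ℓ ℓ-line with lines-to-model ℓ ℓ-line
    ... | N , listed , ℓ≐ with All.lookup size2 listed
    ... | u , v , u≢v , refl =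
      point u , point v , point-injective u≢v , λ x → mk⇔ (forth ∘ ⇔to (ℓ≐ x)) (⇔from (ℓ≐ x) ∘ back)
      where
      forth : ∀ {x} → label x ∈ u ∷ v ∷ [] → x ≡ point u ⊎ x ≡ point v
      forth (here same) = inj₁ (to-point same)
      forth (there (here same)) = inj₂ (to-point same)
      back : ∀ {x} → x ≡ point u ⊎ x ≡ point v → label x ∈ u ∷ v ∷ []
      back (inj₁ same) = here (from-point same)
      back (inj₂ same) = there (here (from-point same))

model-A : Model 3
model-A = checked-model spaceA []

model-B : Model 4
model-B = checked-model spaceB ((# 0 , # 1 , # 2) ∷ [])

model-C : Model 5
model-C = checked-model spaceC ((# 0 , # 1 , # 2) ∷ (# 0 , # 3 , # 4) ∷ [])

model-D : Model 6
model-D = checked-model spaceD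
  ((# 0 , # 1 , # 2) ∷ (# 0 , # 3 , # 4) ∷ (# 1 , # 3 , # 5) ∷ (# 2 , # 4 , # 5) ∷ [])

affine-plane : List (List (Fin 4))
affine-plane = (# 0 ∷ # 1 ∷ []) ∷ (# 0 ∷ # 2 ∷ []) ∷ (# 0 ∷ # 3 ∷ []) ∷
               (# 1 ∷ # 2 ∷ []) ∷ (# 1 ∷ # 3 ∷ []) ∷ (# 2 ∷ # 3 ∷ []) ∷ []

model-affine : Model 4
model-affine = checked-model affine-plane []

fano-triples : List (Triple 7)
fano-triples = (# 0 , # 1 , # 2) ∷ (# 3 , # 0 , # 4) ∷ (# 3 , # 1 , # 5) ∷ (# 3 , # 2 , # 6) ∷
               (# 2 , # 4 , # 5) ∷ (# 1 , # 4 , # 6) ∷ (# 0 , # 5 , # 6) ∷ []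

fano-plane : List (List (Fin 7))
fano-plane = (# 0 ∷ # 1 ∷ # 2 ∷ []) ∷ (# 3 ∷ # 0 ∷ # 4 ∷ []) ∷ (# 3 ∷ # 1 ∷ # 5 ∷ []) ∷
             (# 3 ∷ # 2 ∷ # 6 ∷ []) ∷ (# 2 ∷ # 4 ∷ # 5 ∷ []) ∷ (# 1 ∷ # 4 ∷ # 6 ∷ []) ∷
             (# 0 ∷ # 5 ∷ # 6 ∷ []) ∷ []

model-fano : Model 7
model-fano = checked-model fano-plane fano-triples

affine-plane-axioms : ∀ {k} (Line : Incidence k) → IsomorphicTo Line 4 affine-plane →
                      IsAffinePlaneOfOrder2 Line
affine-plane-axioms Line iso = Transport.affine Line affine-plane iso
  (toWitness {a? = uniqueJoins? affine-plane} _) (toWitness {a? = parallels? affine-plane} _)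
  (toWitness {a? = lines-of-2? affine-plane} _) (# 0) (# 1) (# 2) ((λ ()) , (λ ()) , (λ ()))
  (toWitness {a? = noLineThrough? affine-plane (# 0) (# 1) (# 2)} _)

fano-plane-axioms : ∀ {k} (Line : Incidence k) → IsomorphicTo Line 7 fano-plane →
                    IsProjectivePlaneOfOrder2 Line
fano-plane-axioms Line iso = Transport.projective Line fano-plane iso
  (toWitness {a? = uniqueJoins? fano-plane} _) (toWitness {a? = meets? fano-plane} _)
  (toWitness {a? = lines-of-3? fano-plane} _) (# 0) (# 1) (# 3) (# 6)
  ((λ ()) , (λ ()) , (λ ())) (λ ()) (λ ()) (λ ())
  (toWitness {a? = noLineThrough? fano-plane (# 0) (# 1) (# 3)} _)
  (toWitness {a? = noLineThrough? fano-plane (# 0) (# 1) (# 6)} _)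
  (toWitness {a? = noLineThrough? fano-plane (# 0) (# 3) (# 6)} _)
  (toWitness {a? = noLineThrough? fano-plane (# 1) (# 3) (# 6)} _)

Classification : ∀ {k} → Incidence k → Set₁
Classification {k} Line = HasOneLine Line
    ⊎ (k ≤ 7 × (IsProjectivePlaneOfOrder2 Line ⊎ IsAffinePlaneOfOrder2 Line))
    ⊎ (IsomorphicTo Line 3 spaceA ⊎ IsomorphicTo Line 4 spaceB
       ⊎ IsomorphicTo Line 5 spaceC ⊎ IsomorphicTo Line 6 spaceD)

absent : ∀ {k p} {x : Fin k} {ps : Vec (Fin k) p} → ¬ (x ∈ᵥ ps) → ∀ i → lookup ps i ≢ x
absent {ps = ps} x∉ i same = x∉ (subst (_∈ᵥ ps) same (∈-lookup i ps))

covers-or-misses : ∀ {k p} (ps : Vec (Fin k) p) → (∀ x → x ∈ᵥ ps) ⊎ Σ[ x ∈ Fin k ] ¬ (x ∈ᵥ ps)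
covers-or-misses ps with all? (λ x → Anyᵥ.any? (x ≟_) ps)
... | yes covers = inj₁ covers
... | no misses = inj₂ (¬∀⟶∃¬ _ _ (λ x → Anyᵥ.any? (x ≟_) ps) misses)

module Classify {k : ℕ} (K : KleinColouring k) (Line : Incidence k)
                (lines : ∀ ℓ → Line ℓ ⇔ KleinColouring.IsLine K ℓ) where
  open KleinColouring K
  open Collinearity K

  Col? : ∀ x y z → Dec (Col x y z)
  Col? x y z = (¬? (x ≟ y) ×-dec (¬? (x ≟ z) ×-dec ¬? (y ≟ z))) ×-dec (colour x y ≟G colour x z)

  Monochrome : Fin k → Set
  Monochrome p = ∀ y z → y ≡ p ⊎ z ≡ p ⊎ colour p y ≡ colour p z

  monochrome? : ∀ p y z → Dec (y ≡ p ⊎ z ≡ p ⊎ colour p y ≡ colour p z)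
  monochrome? p y z = (y ≟ p) ⊎-dec ((z ≟ p) ⊎-dec (colour p y ≟G colour p z))

  all-collinear : ∀ {p} → Monochrome p → ∀ i x j → x ≢ i → j ≢ i → colour i x ≡ colour i j
  all-collinear {p} mono i x j x≢i j≢i = from-i (i ≟ p)
    where
    towards-p : i ≢ p → ∀ y → y ≢ i → Dec (y ≡ p) → colour i y ≡ colour i p
    towards-p i≢p y y≢i (yes refl) = refl
    towards-p i≢p y y≢i (no y≢p) with mono y i
    ... | inj₁ y≡p = ⊥-elim (y≢p y≡p)
    ... | inj₂ (inj₁ i≡p) = ⊥-elim (i≢p i≡p)
    ... | inj₂ (inj₂ same) = exchange p y i (≢-sym y≢p) y≢i (≢-sym i≢p) same
    from-i : Dec (i ≡ p) → colour i x ≡ colour i j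
    from-i (yes refl) with mono x j
    ... | inj₁ x≡i = ⊥-elim (x≢i x≡i)
    ... | inj₂ (inj₁ j≡i) = ⊥-elim (j≢i j≡i)
    ... | inj₂ (inj₂ same) = same
    from-i (no i≢p) = trans (towards-p i≢p x x≢i (x ≟ p)) (sym (towards-p i≢p j j≢i (j ≟ p)))

  single-line : ∀ {p} → Monochrome p → Σ[ j ∈ Fin k ] j ≢ p → HasOneLine Line
  single-line {p} mono (j , j≢p) =
    Beam p (colour p j) , ⇔from (lines _) (p , j , j≢p , λ x → mk⇔ id id) , only
    where
    full : ∀ i j' → j' ≢ i → ∀ x → Dec (x ≡ i) → Beam i (colour i j') x
    full i j' j'≢i x (yes x≡i) = inj₁ x≡i
    full i j' j'≢i x (no x≢i) = inj₂ (all-collinear mono i x j' x≢i j'≢i)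
    only : ∀ ℓ → Line ℓ → ℓ ≐ Beam p (colour p j)
    only ℓ ℓ-line with ⇔to (lines ℓ) ℓ-line
    ... | i , j' , j'≢i , ℓ≐ = λ x → mk⇔ (λ _ → full p j j≢p x (x ≟ p))
                                         (λ _ → ⇔from (ℓ≐ x) (full i j' j'≢i x (x ≟ i)))

  module Thin (two-colours : ∀ p → TwoColoured p) where
    open ThinLines K two-colours

    recognise : ∀ {p} (𝕄 : Model p) (ps : Vec (Fin k) p) → Unique ps → (∀ x → x ∈ᵥ ps) →
      All (λ (u , v , w) → Col (lookup ps u) (lookup ps v) (lookup ps w)) (Model.triples 𝕄) →
      {True (triplesDetermined? (Model.triples 𝕄))} → IsomorphicTo Line p (Model.lines 𝕄)
    recognise 𝕄 ps distinct complete collinear {determined} =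
      isomorphic collinear (determined-non-collinear at-most-three (toWitness determined) collinear)
      where open Recognition K Line lines 𝕄 ps distinct complete

    -- Without collinear triples all lines have two points: a triangle, or the
    -- affine plane on four points; a fifth point is excluded by pigeonhole.
    without-triples : (∀ x y z → ¬ Col x y z) → ∀ {p y z} → y ≢ p → z ≢ p → y ≢ z → Classification Line
    without-triples none {p} {y} {z} y≢p z≢p y≢z with covers-or-misses (p ∷ y ∷ z ∷ [])
    ... | inj₁ complete = inj₂ (inj₂ (inj₁ (Recognition.isomorphic K Line lines model-A (p ∷ y ∷ z ∷ [])
            ((≢-sym y≢p ∷ ≢-sym z≢p ∷ []) ∷ (y≢z ∷ []) ∷ [] ∷ []) complete [] (λ _ _ _ _ _ → none _ _ _))))
    ... | inj₂ (w , w∉) with covers-or-misses (p ∷ y ∷ z ∷ w ∷ [])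
    ... | inj₁ complete =
      inj₂ (inj₁ (≤-trans (Transport.size Line affine-plane affine) (s≤s (s≤s (s≤s (s≤s z≤n)))) ,
                  inj₂ (affine-plane-axioms Line affine)))
      where
      affine : IsomorphicTo Line 4 affine-plane
      affine = Recognition.isomorphic K Line lines model-affine (p ∷ y ∷ z ∷ w ∷ [])
        ((≢-sym y≢p ∷ ≢-sym z≢p ∷ absent w∉ (# 0) ∷ []) ∷ (y≢z ∷ absent w∉ (# 1) ∷ []) ∷
         (absent w∉ (# 2) ∷ []) ∷ [] ∷ []) complete [] (λ _ _ _ _ _ → none _ _ _)
    ... | inj₂ (w' , w'∉) = ⊥-elim (no-collinear-pair (pigeonhole-at p y z w w' y≢p z≢p
            (≢-sym (absent w∉ (# 0))) (≢-sym (absent w'∉ (# 0))) y≢z (absent w∉ (# 1)) (absent w'∉ (# 1))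
            (absent w∉ (# 2)) (absent w'∉ (# 2)) (absent w'∉ (# 3))))
      where
      no-collinear-pair : Col p y z ⊎ Col p y w ⊎ Col p y w' ⊎ Col p z w ⊎ Col p z w' ⊎ Col p w w' → ⊥
      no-collinear-pair (inj₁ col) = none _ _ _ col
      no-collinear-pair (inj₂ (inj₁ col)) = none _ _ _ col
      no-collinear-pair (inj₂ (inj₂ (inj₁ col))) = none _ _ _ col
      no-collinear-pair (inj₂ (inj₂ (inj₂ (inj₁ col)))) = none _ _ _ col
      no-collinear-pair (inj₂ (inj₂ (inj₂ (inj₂ (inj₁ col))))) = none _ _ _ col
      no-collinear-pair (inj₂ (inj₂ (inj₂ (inj₂ (inj₂ col))))) = none _ _ _ col

    -- A frame: a line a b d and a point q off it.  Every other point lies on one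
    -- of the lines qa, qb, qd, each of which has at most one further point.
    module Frame {a b d q : Fin k} (abd : Col a b d) (q≢a : q ≢ a) (q≢b : q ≢ b) (q≢d : q ≢ d) where

      a≢b : a ≢ b
      a≢b = proj₁ (proj₁ abd)
      a≢d : a ≢ d
      a≢d = proj₁ (proj₂ (proj₁ abd))
      b≢d : b ≢ d
      b≢d = proj₂ (proj₂ (proj₁ abd))

      q-off : ∀ {s t u} → Col s t u → q ≢ u → ¬ Col q s t
      q-off stu q≢u qst = q≢u (sym (third-unique stu (Col-rotate⁻¹ qst)))

      not-qab : ¬ Col q a b
      not-qab = q-off abd q≢d
      not-qba : ¬ Col q b a
      not-qba = q-off (Col-flip abd) q≢d
      not-qad : ¬ Col q a d
      not-qad = q-off (Col-swap abd) q≢b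
      not-qda : ¬ Col q d a
      not-qda = q-off (Col-rotate abd) q≢b
      not-qbd : ¬ Col q b d
      not-qbd = q-off (Col-rotate⁻¹ abd) q≢a
      not-qdb : ¬ Col q d b
      not-qdb = q-off (Col-reverse abd) q≢a

      frame : Vec (Fin k) 4
      frame = a ∷ b ∷ d ∷ q ∷ []

      -- every point is in the frame or on one of the lines qa, qb, qd:
      -- q sees a, b, d in three different colours
      frame-cover : ∀ x → x ∈ᵥ frame ⊎ Col q a x ⊎ Col q b x ⊎ Col q d x
      frame-cover x with x ≟ a | x ≟ b | x ≟ d | x ≟ q
      ... | yes x≡a | _ | _ | _ = inj₁ (here x≡a)
      ... | no _ | yes x≡b | _ | _ = inj₁ (there (here x≡b))
      ... | no _ | no _ | yes x≡d | _ = inj₁ (there (there (here x≡d)))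
      ... | no _ | no _ | no _ | yes x≡q = inj₁ (there (there (there (here x≡q))))
      ... | no x≢a | no x≢b | no x≢d | no x≢q
        with pigeonhole-at q a b d x (≢-sym q≢a) (≢-sym q≢b) (≢-sym q≢d) x≢q a≢b a≢d (≢-sym x≢a) b≢d
                           (≢-sym x≢b) (≢-sym x≢d)
      ... | inj₁ qab = ⊥-elim (not-qab qab)
      ... | inj₂ (inj₁ qad) = ⊥-elim (not-qad qad)
      ... | inj₂ (inj₂ (inj₁ qax)) = inj₂ (inj₁ qax)
      ... | inj₂ (inj₂ (inj₂ (inj₁ qbd))) = ⊥-elim (not-qbd qbd)
      ... | inj₂ (inj₂ (inj₂ (inj₂ (inj₁ qbx)))) = inj₂ (inj₂ (inj₁ qbx))
      ... | inj₂ (inj₂ (inj₂ (inj₂ (inj₂ qdx)))) = inj₂ (inj₂ (inj₂ qdx))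

      third≢ : ∀ {s s' t} → Col q s s' → ¬ Col q s t → s' ≢ t
      third≢ qss' not-qst refl = not-qst qss'

      thirds≢ : ∀ {s s' t t'} → s ≢ t → Col q s s' → Col q t t' → ¬ Col q s t → s' ≢ t'
      thirds≢ s≢t ((q≢s , _) , qs≡qs') ((q≢t , _) , qt≡qt') not-qst refl =
        not-qst ((q≢s , q≢t , s≢t) , trans qs≡qs' (sym qt≡qt'))

      -- Thirds a' of qa and b' of qb are collinear with d, unless a' or b' lies
      -- on qd: d sees a, q, a', b' in only three colours.
      opposite : ∀ {a' b'} → Col q a a' → Col q b b' → ¬ Col q d a' → ¬ Col q d b' → Col d a' b'
      opposite {a'} {b'} qaa'@((_ , q≢a' , a≢a') , _) qbb'@((_ , q≢b' , b≢b') , _) not-qda' not-qdb'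
        with pigeonhole-at d a q a' b' a≢d q≢d (third≢ qaa' not-qad) (third≢ qbb' not-qbd)
               (≢-sym q≢a) a≢a' (≢-sym (third≢ qbb' not-qba)) q≢a' q≢b' (thirds≢ a≢b qaa' qbb' not-qab)
      ... | inj₁ daq = ⊥-elim (not-qad (Col-reverse daq))
      ... | inj₂ (inj₁ daa') = ⊥-elim (third≢ qaa' not-qab (sym (third-unique (Col-rotate abd) daa')))
      ... | inj₂ (inj₂ (inj₁ dab')) = ⊥-elim (b≢b' (third-unique (Col-rotate abd) dab'))
      ... | inj₂ (inj₂ (inj₂ (inj₁ dqa'))) = ⊥-elim (not-qda' (Col-flip dqa'))
      ... | inj₂ (inj₂ (inj₂ (inj₂ (inj₁ dqb')))) = ⊥-elim (not-qdb' (Col-flip dqb'))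
      ... | inj₂ (inj₂ (inj₂ (inj₂ (inj₂ da'b')))) = da'b'

      NoThird : Fin k → Set
      NoThird s = ∀ z → ¬ Col q s z

      four-points : NoThird a → NoThird b → NoThird d → Classification Line
      four-points none-a none-b none-d = inj₂ (inj₂ (inj₂ (inj₁ (recognise model-B frame
        ((a≢b ∷ a≢d ∷ ≢-sym q≢a ∷ []) ∷ (b≢d ∷ ≢-sym q≢b ∷ []) ∷ (≢-sym q≢d ∷ []) ∷ [] ∷ [])
        complete (abd ∷ [])))))
        where
        complete : ∀ x → x ∈ᵥ frame
        complete x with frame-cover x
        ... | inj₁ x∈frame = x∈frame
        ... | inj₂ (inj₁ qax) = ⊥-elim (none-a x qax)
        ... | inj₂ (inj₂ (inj₁ qbx)) = ⊥-elim (none-b x qbx)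
        ... | inj₂ (inj₂ (inj₂ qdx)) = ⊥-elim (none-d x qdx)

      five-points : ∀ {a'} → Col q a a' → NoThird b → NoThird d → Classification Line
      five-points {a'} qaa'@((_ , q≢a' , a≢a') , _) none-b none-d =
        inj₂ (inj₂ (inj₂ (inj₂ (inj₁ (recognise model-C (frame ++ a' ∷ [])
          ((a≢b ∷ a≢d ∷ ≢-sym q≢a ∷ a≢a' ∷ []) ∷ (b≢d ∷ ≢-sym q≢b ∷ ≢-sym (third≢ qaa' not-qab) ∷ []) ∷
           (≢-sym q≢d ∷ ≢-sym (third≢ qaa' not-qad) ∷ []) ∷ (q≢a' ∷ []) ∷ [] ∷ [])
          complete (abd ∷ Col-flip qaa' ∷ []))))))
        where
        complete : ∀ x → x ∈ᵥ frame ++ a' ∷ []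
        complete x with frame-cover x
        ... | inj₁ x∈frame = ∈-++⁺ˡ x∈frame
        ... | inj₂ (inj₁ qax) = ∈-++⁺ʳ frame (here (sym (third-unique qaa' qax)))
        ... | inj₂ (inj₂ (inj₁ qbx)) = ⊥-elim (none-b x qbx)
        ... | inj₂ (inj₂ (inj₂ qdx)) = ⊥-elim (none-d x qdx)

      six-points : ∀ {a' b'} → Col q a a' → Col q b b' → NoThird d → Classification Line
      six-points {a'} {b'} qaa'@((_ , q≢a' , a≢a') , _) qbb'@((_ , q≢b' , b≢b') , _) none-d =
        inj₂ (inj₂ (inj₂ (inj₂ (inj₂ (recognise model-D (frame ++ a' ∷ b' ∷ [])
          ((a≢b ∷ a≢d ∷ ≢-sym q≢a ∷ a≢a' ∷ ≢-sym (third≢ qbb' not-qba) ∷ []) ∷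
           (b≢d ∷ ≢-sym q≢b ∷ ≢-sym (third≢ qaa' not-qab) ∷ b≢b' ∷ []) ∷
           (≢-sym q≢d ∷ ≢-sym (third≢ qaa' not-qad) ∷ ≢-sym (third≢ qbb' not-qbd) ∷ []) ∷
           (q≢a' ∷ q≢b' ∷ []) ∷ (thirds≢ a≢b qaa' qbb' not-qab ∷ []) ∷ [] ∷ [])
          complete
          (abd ∷ Col-flip qaa' ∷ Col-flip qbb' ∷ opposite qaa' qbb' (none-d a') (none-d b') ∷ []))))))
        where
        complete : ∀ x → x ∈ᵥ frame ++ a' ∷ b' ∷ []
        complete x with frame-cover x
        ... | inj₁ x∈frame = ∈-++⁺ˡ x∈frame
        ... | inj₂ (inj₁ qax) = ∈-++⁺ʳ frame (here (sym (third-unique qaa' qax)))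
        ... | inj₂ (inj₂ (inj₁ qbx)) = ∈-++⁺ʳ frame (there (here (sym (third-unique qbb' qbx))))
        ... | inj₂ (inj₂ (inj₂ qdx)) = ⊥-elim (none-d x qdx)

    seven-points : ∀ {a b d q a' b' d'} → Col a b d → q ≢ a → q ≢ b → q ≢ d →
                   Col q a a' → Col q b b' → Col q d d' → Classification Line
    seven-points {a} {b} {d} {q} {a'} {b'} {d'} abd q≢a q≢b q≢d
                 qaa'@((_ , q≢a' , a≢a') , _) qbb'@((_ , q≢b' , b≢b') , _) qdd'@((_ , q≢d' , d≢d') , _) =
      inj₂ (inj₁ (Transport.size Line fano-plane fano , inj₁ (fano-plane-axioms Line fano)))
      where
      open Frame abd q≢a q≢b q≢d
      a'≢b' : a' ≢ b'
      a'≢b' = thirds≢ a≢b qaa' qbb' not-qab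
      a'≢d' : a' ≢ d'
      a'≢d' = thirds≢ a≢d qaa' qdd' not-qad
      b'≢d' : b' ≢ d'
      b'≢d' = thirds≢ b≢d qbb' qdd' not-qbd
      -- the three remaining lines, one from each frame obtained by permuting a, b, d
      da'b' : Col d a' b'
      da'b' = opposite qaa' qbb' (λ qda' → a'≢d' (sym (third-unique qdd' qda')))
                                 (λ qdb' → b'≢d' (sym (third-unique qdd' qdb')))
      ba'd' : Col b a' d'
      ba'd' = Frame.opposite (Col-swap abd) q≢a q≢d q≢b qaa' qdd'
                (λ qba' → a'≢b' (sym (third-unique qbb' qba'))) (λ qbd' → b'≢d' (third-unique qbb' qbd'))
      ab'd' : Col a b' d'
      ab'd' = Frame.opposite (Col-rotate⁻¹ abd) q≢b q≢d q≢a qbb' qdd'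
                (λ qab' → a'≢b' (third-unique qaa' qab')) (λ qad' → a'≢d' (third-unique qaa' qad'))
      complete : ∀ x → x ∈ᵥ frame ++ a' ∷ b' ∷ d' ∷ []
      complete x with frame-cover x
      ... | inj₁ x∈frame = ∈-++⁺ˡ x∈frame
      ... | inj₂ (inj₁ qax) = ∈-++⁺ʳ frame (here (sym (third-unique qaa' qax)))
      ... | inj₂ (inj₂ (inj₁ qbx)) = ∈-++⁺ʳ frame (there (here (sym (third-unique qbb' qbx))))
      ... | inj₂ (inj₂ (inj₂ qdx)) = ∈-++⁺ʳ frame (there (there (here (sym (third-unique qdd' qdx)))))
      fano : IsomorphicTo Line 7 fano-plane
      fano = recognise model-fano (frame ++ a' ∷ b' ∷ d' ∷ [])
        ((a≢b ∷ a≢d ∷ ≢-sym q≢a ∷ a≢a' ∷ ≢-sym (third≢ qbb' not-qba) ∷ ≢-sym (third≢ qdd' not-qda) ∷ []) ∷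
         (b≢d ∷ ≢-sym q≢b ∷ ≢-sym (third≢ qaa' not-qab) ∷ b≢b' ∷ ≢-sym (third≢ qdd' not-qdb) ∷ []) ∷
         (≢-sym q≢d ∷ ≢-sym (third≢ qaa' not-qad) ∷ ≢-sym (third≢ qbb' not-qbd) ∷ d≢d' ∷ []) ∷
         (q≢a' ∷ q≢b' ∷ q≢d' ∷ []) ∷ (a'≢b' ∷ a'≢d' ∷ []) ∷ (b'≢d' ∷ []) ∷ [] ∷ [])
        complete (abd ∷ qaa' ∷ qbb' ∷ qdd' ∷ da'b' ∷ ba'd' ∷ ab'd' ∷ [])

    with-line : ∀ {a b d} → Col a b d → Classification Line
    with-line {a} {b} {d} abd with off-line a (colour a b)
    ... | q , q≢a , aq≢ab = by-thirds (any? (Col? q a)) (any? (Col? q b)) (any? (Col? q d))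
      where
      q≢b : q ≢ b
      q≢b refl = aq≢ab refl
      q≢d : q ≢ d
      q≢d refl = aq≢ab (sym (proj₂ abd))
      by-thirds : Dec (Σ[ z ∈ Fin k ] Col q a z) → Dec (Σ[ z ∈ Fin k ] Col q b z) →
                  Dec (Σ[ z ∈ Fin k ] Col q d z) → Classification Line
      by-thirds (no ∄a) (no ∄b) (no ∄d) =
        Frame.four-points abd q≢a q≢b q≢d (λ z col → ∄a (z , col)) (λ z col → ∄b (z , col))
                                          (λ z col → ∄d (z , col))
      by-thirds (yes (_ , qaa')) (no ∄b) (no ∄d) =
        Frame.five-points abd q≢a q≢b q≢d qaa' (λ z col → ∄b (z , col)) (λ z col → ∄d (z , col))
      by-thirds (no ∄a) (yes (_ , qbb')) (no ∄d) =
        Frame.five-points (Col-flip abd) q≢b q≢a q≢d qbb' (λ z col → ∄a (z , col)) (λ z col → ∄d (z , col))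
      by-thirds (no ∄a) (no ∄b) (yes (_ , qdd')) =
        Frame.five-points (Col-rotate abd) q≢d q≢a q≢b qdd' (λ z col → ∄a (z , col)) (λ z col → ∄b (z , col))
      by-thirds (yes (_ , qaa')) (yes (_ , qbb')) (no ∄d) =
        Frame.six-points abd q≢a q≢b q≢d qaa' qbb' (λ z col → ∄d (z , col))
      by-thirds (yes (_ , qaa')) (no ∄b) (yes (_ , qdd')) =
        Frame.six-points (Col-swap abd) q≢a q≢d q≢b qaa' qdd' (λ z col → ∄b (z , col))
      by-thirds (no ∄a) (yes (_ , qbb')) (yes (_ , qdd')) =
        Frame.six-points (Col-rotate⁻¹ abd) q≢b q≢d q≢a qbb' qdd' (λ z col → ∄a (z , col))
      by-thirds (yes (_ , qaa')) (yes (_ , qbb')) (yes (_ , qdd')) =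
        seven-points abd q≢a q≢b q≢d qaa' qbb' qdd'

    thin : Fin k → Classification Line
    thin p with any? (λ x → any? λ y → any? λ z → Col? x y z)
    ... | yes (a , b , d , abd) = with-line abd
    ... | no none with two-colours p
    ... | y , z , y≢p , z≢p , py≢pz =
      without-triples (λ x y z col → none (x , y , z , col)) y≢p z≢p (λ y≡z → py≢pz (cong (colour p) y≡z))

  classify : Fin k → (∀ i → Σ[ j ∈ Fin k ] j ≢ i) → Classification Line
  classify p₀ other with any? (λ p → all? λ y → all? λ z → monochrome? p y z)
  ... | yes (p , mono) = inj₁ (single-line mono (other p))
  ... | no none = Thin.thin two-colours p₀
    where
    two-colours : ∀ p → TwoColoured p
    two-colours p with ¬∀⟶∃¬ k _ (λ y → all? λ z → monochrome? p y z) (λ mono → none (p , mono))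
    ... | y , not-all with ¬∀⟶∃¬ k _ (monochrome? p y) not-all
    ... | z , distinct = y , z , (λ y≡p → distinct (inj₁ y≡p)) , (λ z≡p → distinct (inj₂ (inj₁ z≡p))) ,
                         (λ same → distinct (inj₂ (inj₂ same)))

-- Fibres exist because Ω is nonempty, and every
-- fibre has a second one by hypothesis.
corollary4p4 : (n m k : ℕ) → 0 < n →
    (rel : Fin n → Fin n → Fin m) → IsCoherentConfiguration rel →
    (ι : Fin k → Fin m) → IsFiberIndexing rel ι →
    IsKleinConfiguration rel ι →
    (φ : Fin k → G → Fin m) → IsFiberIsomorphisms rel ι φ →
    (∀ i j → i ≢ j → Σ[ g ∈ G ] (g ≢ e × R rel ι φ i j g)) →
    (∀ i → Σ[ j ∈ Fin k ] (j ≢ i × Σ[ g ∈ G ] ¬ R rel ι φ j i g)) →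
    (∀ i j → Σ[ g ∈ G ] ¬ R rel ι φ i j g) →
    HasOneLine (𝒢 rel ι φ)
    ⊎ (k ≤ 7 × (IsProjectivePlaneOfOrder2 (𝒢 rel ι φ) ⊎ IsAffinePlaneOfOrder2 (𝒢 rel ι φ)))
    ⊎ (IsomorphicTo (𝒢 rel ι φ) 3 spaceA ⊎ IsomorphicTo (𝒢 rel ι φ) 4 spaceB
       ⊎ IsomorphicTo (𝒢 rel ι φ) 5 spaceC ⊎ IsomorphicTo (𝒢 rel ι φ) 6 spaceD)
corollary4p4 (suc n) m k _ rel cc ι fi _ φ fs reduced second-fibre proper =
  Classify.classify klein-colouring (𝒢 rel ι φ) lines first-fibre other-fibre
  where
  open ReducedColouring rel cc ι fi φ fs reduced proper using (klein-colouring; lines)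
  first-fibre : Fin k
  first-fibre = proj₁ (IsFiberIndexing.ι-onto fi zero)
  other-fibre : ∀ i → Σ[ j ∈ Fin k ] j ≢ i
  other-fibre i = proj₁ (second-fibre i) , proj₁ (proj₂ (second-fibre i))
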